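{- Let $G$ be a finite, simple, connected graph with at least one edge, on vertex set $\{1,\dots,N\}$, let $\nabla_G=\{\pm(\mathbf e_i-\mathbf e_j)\mid \{i,j\}\in\mathcal E(G)\}\subset\mathbb R^N$, and let $F$ be a nonempty proper face of $\nabla_G$. Then: (i) $F$ is affinely independent if and only if $G_F$ is a forest; (ii) $F$ is a circuit if and only if $G_F$ is a chordless cycle; (iii) $\dim(F)=|\mathcal V(G_F)|-k-1$, where $k$ is the number of connected components of $G_F$; (iv) the corank of $F$ equals the cyclomatic number of $G_F$.
   Context: $\mathbf e_1,\dots,\mathbf e_N$ is the standard basis of $\mathbb R^N$. A subset $F\subseteq\nabla_G$ is a face of $\nabla_G$ if $F=\nabla_G\cap P'$ for a face $P'$ of the polytope $\operatorname{conv}(\nabla_G)$. $G_F$ is the undirected graph whose edges are the $\{i,j\}$ with $\mathbf e_i-\mathbf e_j\in F$ or $\mathbf e_j-\mathbf e_i\in F$, and whose vertices are the endpoints of these edges. For a finite point set $X$: $\dim(X)=\dim\operatorname{conv}(X)$; $X$ is affinely dependent if there are reals $\lambda_x$, not all zero, with $\sum\lambda_x=0$ and $\sum\lambda_x x=\mathbf 0$, and affinely independent otherwise; $X$ is a circuit if it is affinely dependent but every proper subset is affinely independent; the corank of $X$ is $|X|-\dim(X)-1$. The cyclomatic number of a graph is $|\mathcal E|-|\mathcal V|+(\text{number of connected components})$, the minimum number of edges whose deletion makes it acyclic.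
   Formalization: The linear functionals cutting out faces of $\operatorname{conv}(\nabla_G)$ and the coefficients $\lambda_x$ in affine dependence are taken in ℚ rather than ℝ. -}

module Defs where

open import Data.Bool using (Bool; true; false; if_then_else_; _∨_; _∧_)
open import Data.Nat as ℕ using (ℕ; zero; suc; _<ᵇ_)
open import Data.Fin using (Fin; zero; suc; toℕ; _≟_)
open import Data.Integer as ℤ using (ℤ; +_)
open import Data.Rational as ℚ using (ℚ; 0ℚ; 1ℚ)
open import Data.Product using (Σ; ∃; ∃-syntax; _×_; _,_)
open import Data.Sum using (_⊎_)
open import Relation.Nullary using (¬_; yes; no)
open import Relation.Binary.PropositionalEquality using (_≡_; _≢_)
open import Function.Bundles using (_⇔_)

∑ : ∀ {n} → (Fin n → ℚ) → ℚ
∑ {zero}  f = 0ℚ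
∑ {suc n} f = f zero ℚ.+ ∑ (λ i → f (suc i))

∑ℕ : ∀ {n} → (Fin n → ℕ) → ℕ
∑ℕ {zero}  f = 0
∑ℕ {suc n} f = f zero ℕ.+ ∑ℕ (λ i → f (suc i))

anyFin : ∀ {n} → (Fin n → Bool) → Bool
anyFin {zero}  f = false
anyFin {suc n} f = f zero ∨ anyFin (λ i → f (suc i))

Vecℚ : ℕ → Set
Vecℚ N = Fin N → ℚ

e : ∀ {N} → Fin N → Vecℚ N
e i k with i ≟ k
... | yes _ = 1ℚ
... | no  _ = 0ℚ

root : ∀ {N} → Fin N → Fin N → Vecℚ N
root i j k = e i k ℚ.- e j k

_·_ : ∀ {N} → Vecℚ N → Vecℚ N → ℚ
c · x = ∑ (λ k → c k ℚ.* x k)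

Graph : ℕ → Set
Graph N = Fin N → Fin N → Bool

IsSimple : ∀ {N} → Graph N → Set
IsSimple {N} A = (∀ i j → A i j ≡ A j i) × (∀ i → A i i ≡ false)

data Walk {N} (A : Graph N) : Fin N → Fin N → Set where
  here : ∀ {u} → Walk A u u
  step : ∀ {u v w} → A u v ≡ true → Walk A v w → Walk A u w

IsConnected : ∀ {N} → Graph N → Set
IsConnected {N} A = ∀ (u v : Fin N) → Walk A u v

HasEdge : ∀ {N} → Graph N → Set
HasEdge A = ∃[ i ] ∃[ j ] A i j ≡ true

-- Subsets of ∇_G.
-- ∇_G = { e_i - e_j | A i j } (A symmetric, so this is ±(e_i-e_j) for
-- edges {i,j}). Since (i,j) ↦ e_i - e_j is injective on pairs with i ≢ j,
-- a subset of ∇_G is encoded as a Bool matrix S of ordered pairs,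
-- S i j = true meaning e_i - e_j ∈ S.

PairSet : ℕ → Set
PairSet N = Fin N → Fin N → Bool

_⊆_ : ∀ {N} → PairSet N → PairSet N → Set
S ⊆ T = ∀ i j → S i j ≡ true → T i j ≡ true

_⊂_ : ∀ {N} → PairSet N → PairSet N → Set
S ⊂ T = S ⊆ T × (∃[ i ] ∃[ j ] (T i j ≡ true × S i j ≡ false))

∇ : ∀ {N} → Graph N → PairSet N
∇ A = A

∣_∣ : ∀ {N} → PairSet N → ℕ
∣ S ∣ = ∑ℕ (λ i → ∑ℕ (λ j → if S i j then 1 else 0))

Nonempty : ∀ {N} → PairSet N → Set
Nonempty S = ∃[ i ] ∃[ j ] S i j ≡ true

-- Faces of ∇_G: F = ∇_G ∩ P' with P' a face of conv(∇_G), i.e. P' is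
-- empty or P' = {x ∈ conv ∇_G | c·x = max_{conv ∇_G} c·} for a linear
-- functional c (c = 0 gives P' = conv ∇_G). The max over conv(∇_G) is
-- attained at points of ∇_G.

IsFace : ∀ {N} → (A : Graph N) → PairSet N → Set
IsFace {N} A F =
    (∀ i j → F i j ≡ false)
  ⊎ (Σ (Vecℚ N) λ c → ∀ i j →
        (F i j ≡ true) ⇔
        (A i j ≡ true × (∀ k l → A k l ≡ true → c · root k l ℚ.≤ c · root i j)))

AffinelyDependent : ∀ {N} → PairSet N → Set
AffinelyDependent {N} S =
  Σ (Fin N → Fin N → ℚ) λ λ' →
      (∀ i j → S i j ≡ false → λ' i j ≡ 0ℚ)
    × (∃[ i ] ∃[ j ] λ' i j ≢ 0ℚ)
    × (∑ (λ i → ∑ (λ j → λ' i j)) ≡ 0ℚ)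
    × (∀ k → ∑ (λ i → ∑ (λ j → λ' i j ℚ.* root i j k)) ≡ 0ℚ)

AffinelyIndependent : ∀ {N} → PairSet N → Set
AffinelyIndependent S = ¬ AffinelyDependent S

IsCircuit : ∀ {N} → PairSet N → Set
IsCircuit S = AffinelyDependent S × (∀ S' → S' ⊂ S → AffinelyIndependent S')

-- dim(X) = dim conv(X) = (max size of an affinely independent subset) - 1
HasDim : ∀ {N} → PairSet N → ℕ → Set
HasDim S d =
    (∃[ S' ] (S' ⊆ S × AffinelyIndependent S' × ∣ S' ∣ ≡ suc d))
  × (∀ S' → S' ⊆ S → AffinelyIndependent S' → ∣ S' ∣ ℕ.≤ suc d)

-- corank of S, given that dim(S) = d
corank : ∀ {N} → PairSet N → ℕ → ℤ
corank S d = (+ ∣ S ∣) ℤ.- (+ d) ℤ.- ℤ.1ℤ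

EdgeF : ∀ {N} → PairSet N → Fin N → Fin N → Bool
EdgeF F i j = F i j ∨ F j i

VertF : ∀ {N} → PairSet N → Fin N → Bool
VertF F v = anyFin (λ u → EdgeF F u v)

numVertF : ∀ {N} → PairSet N → ℕ
numVertF F = ∑ℕ (λ v → if VertF F v then 1 else 0)

numEdgeF : ∀ {N} → PairSet N → ℕ
numEdgeF F = ∑ℕ (λ i → ∑ℕ (λ j →
  if (toℕ i <ᵇ toℕ j) ∧ EdgeF F i j then 1 else 0))

-- G_F has exactly k connected components: the vertices of G_F map onto
-- Fin k with two vertices identified iff joined by a walk in G_F.
HasComponents : ∀ {N} → PairSet N → ℕ → Set
HasComponents {N} F k =
  Σ ((v : Fin N) → VertF F v ≡ true → Fin k) λ comp →
      (∀ (c : Fin k) → ∃[ v ] Σ (VertF F v ≡ true) λ p → comp v p ≡ c)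
    × (∀ u (p : VertF F u ≡ true) v (q : VertF F v ≡ true) →
         (comp u p ≡ comp v q) ⇔ Walk (EdgeF F) u v)

cyclomatic : ∀ {N} → PairSet N → ℕ → ℤ
cyclomatic F k = (+ numEdgeF F) ℤ.- (+ numVertF F) ℤ.+ (+ k)

Consec : (m : ℕ) → Fin m → Fin m → Set
Consec m s t = (toℕ t ≡ suc (toℕ s)) ⊎ (suc (toℕ s) ≡ m × toℕ t ≡ 0)

InjectiveSeq : ∀ {m N} → (Fin m → Fin N) → Set
InjectiveSeq v = ∀ s t → v s ≡ v t → s ≡ t

HasCycle : ∀ {N} → PairSet N → Set
HasCycle {N} F =
  ∃[ m ] (3 ℕ.≤ m × Σ (Fin m → Fin N) λ v →
     InjectiveSeq v × (∀ s t → Consec m s t → EdgeF F (v s) (v t) ≡ true))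

IsForest : ∀ {N} → PairSet N → Set
IsForest F = ¬ HasCycle F

IsChordlessCycle : ∀ {N} → PairSet N → Set
IsChordlessCycle {N} F =
  ∃[ m ] (3 ℕ.≤ m × Σ (Fin m → Fin N) λ v →
       InjectiveSeq v
     × (∀ x → (VertF F x ≡ true) ⇔ (∃[ s ] v s ≡ x))
     × (∀ a b → (EdgeF F a b ≡ true) ⇔
          (∃[ s ] ∃[ t ] (Consec m s t × ((a ≡ v s × b ≡ v t) ⊎ (a ≡ v t × b ≡ v s))))))

-- Let c be the functional defining the proper face F and λ the maximum of c on ∇_G. Every
-- e_i − e_j in F has c-value λ, and λ ≠ 0: if λ = 0, then c(e_i − e_j) = −c(e_j − e_i) ≥ 0 for
-- every edge {i, j}, so every point of ∇_G would attain the maximum and lie in F. Hence F contains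
-- no loop and never both e_i − e_j and e_j − e_i, i.e. F is an orientation of G_F, and the
-- coefficients of a linear relation among points of F sum to zero, so on subsets of F affine and
-- linear dependence agree. The theorem thus concerns the graphic matroid of G_F. In the support of
-- a linear relation no vertex has a single neighbour (it would carry a nonzero net flow), so the
-- support contains a cycle; conversely the signed edges of a cycle telescope to zero. Hence the
-- independent sets are the forests and the circuits the chordless cycles. The rank of F is
-- |V(G_F)| − k: with a root chosen in every component, the coordinates at the other vertices
-- determine any combination of edges (its coordinates sum to zero over each component), and a
-- maximal independent subset of F spans every e_v − e_root(v) along a walk. Each edge of G_F comes
-- from exactly one point of F, so |F| = |E(G_F)| and the corank |F| − dim F − 1 is the cyclomatic
-- number.

module Submission where

open import Algebra.Bundles using (CommutativeMonoid)
import Algebra.Properties.CommutativeSemigroup as CommutativeSemigroupProperties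
import Algebra.Properties.Group as GroupProperties
open import Axiom.UniquenessOfIdentityProofs using (module Decidable⇒UIP)
open import Data.Bool as Bool using (Bool; true; false; not; _∧_; _∨_; if_then_else_)
open import Data.Bool.Properties
  using (∧-zeroʳ; ∧-identityʳ; ∧-conicalˡ; ∧-conicalʳ; ∨-zeroʳ; ∨-comm; ∨-idem; ¬-not; ⇔→≡)
open import Data.Empty using (⊥; ⊥-elim)
open import Data.Fin as Fin using (Fin; zero; suc; toℕ; fromℕ; fromℕ<; inject₁)
open import Data.Fin.Properties
  using (suc-injective; toℕ-injective; toℕ<n; toℕ-fromℕ; toℕ-fromℕ<; toℕ-inject₁; any?; pigeonhole)
import Data.Integer as ℤ
import Data.Integer.Properties as ℤ
open import Data.Integer.Solver using () renaming (module +-*-Solver to ℤ-Solver)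
open import Data.Nat as ℕ using (ℕ; zero; suc; _≤_; _<_; z≤n; s≤s; _∸_; _<ᵇ_)
import Data.Nat.Properties as ℕ
open import Data.Nat.Induction using (<-wellFounded)
open import Data.Product using (Σ; ∃; ∃₂; ∃-syntax; _×_; _,_; proj₁; proj₂; uncurry)
open import Data.Rational as ℚ using (ℚ; 0ℚ; 1ℚ; _+_; _*_; -_; 1/_)
import Data.Rational.Properties as ℚ
open import Data.Rational.Solver using (module +-*-Solver)
open import Data.Sum using (_⊎_; inj₁; inj₂)
open import Function.Base using (_∘_)
open import Function.Bundles using (_⇔_; mk⇔; Equivalence)
open import Induction.WellFounded using (Acc; acc)
open import Relation.Binary.Definitions using (DecidableEquality; tri<; tri≈; tri>)
open import Relation.Binary.PropositionalEquality
open import Relation.Nullary using (¬_; Dec; yes; no; does; contradiction)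
open import Relation.Nullary.Decidable using (dec-true; dec-false; ¬?; _×-dec_; _⊎-dec_)

open import Defs

private
  module ℚ+ = CommutativeSemigroupProperties (CommutativeMonoid.commutativeSemigroup ℚ.+-0-commutativeMonoid)
  module ℕ+ = CommutativeSemigroupProperties ℕ.+-commutativeSemigroup
  module ℚ-group = GroupProperties ℚ.+-0-group

∑-cong : ∀ {n} {f g : Fin n → ℚ} → (∀ i → f i ≡ g i) → ∑ f ≡ ∑ g
∑-cong {zero}  eq = refl
∑-cong {suc n} eq = cong₂ _+_ (eq zero) (∑-cong (eq ∘ suc))

∑-distrib-+ : ∀ {n} (f g : Fin n → ℚ) → ∑ (λ i → f i + g i) ≡ ∑ f + ∑ g
∑-distrib-+ {zero}  f g = refl
∑-distrib-+ {suc n} f g = begin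
  (f zero + g zero) + ∑ (λ i → f (suc i) + g (suc i))
    ≡⟨ cong (f zero + g zero +_) (∑-distrib-+ (f ∘ suc) (g ∘ suc)) ⟩
  (f zero + g zero) + (∑ (f ∘ suc) + ∑ (g ∘ suc))
    ≡⟨ ℚ+.interchange (f zero) (g zero) _ _ ⟩
  (f zero + ∑ (f ∘ suc)) + (g zero + ∑ (g ∘ suc)) ∎
  where open ≡-Reasoning

*-distribˡ-∑ : ∀ {n} c (f : Fin n → ℚ) → c * ∑ f ≡ ∑ (λ i → c * f i)
*-distribˡ-∑ {zero}  c f = ℚ.*-zeroʳ c
*-distribˡ-∑ {suc n} c f =
  trans (ℚ.*-distribˡ-+ c (f zero) (∑ (f ∘ suc))) (cong (c * f zero +_) (*-distribˡ-∑ c (f ∘ suc)))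

∑-zero : ∀ {n} (f : Fin n → ℚ) → (∀ i → f i ≡ 0ℚ) → ∑ f ≡ 0ℚ
∑-zero {zero}  f eq = refl
∑-zero {suc n} f eq = cong₂ _+_ (eq zero) (∑-zero (f ∘ suc) (eq ∘ suc))

∑-point : ∀ {n} (f : Fin n → ℚ) p → (∀ i → i ≢ p → f i ≡ 0ℚ) → ∑ f ≡ f p
∑-point {suc n} f zero    eq =
  trans (cong (f zero +_) (∑-zero (f ∘ suc) (λ i → eq (suc i) λ ()))) (ℚ.+-identityʳ (f zero))
∑-point {suc n} f (suc p) eq =
  trans (cong₂ _+_ (eq zero λ ()) (∑-point (f ∘ suc) p (λ i i≢p → eq (suc i) (i≢p ∘ suc-injective))))
        (ℚ.+-identityˡ (f (suc p)))

∑-init-last : ∀ {n} (f : Fin (suc n) → ℚ) → ∑ f ≡ ∑ (f ∘ inject₁) + f (fromℕ n)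
∑-init-last {zero}  f = trans (ℚ.+-identityʳ (f zero)) (sym (ℚ.+-identityˡ (f zero)))
∑-init-last {suc n} f =
  trans (cong (f zero +_) (∑-init-last (f ∘ suc))) (sym (ℚ.+-assoc (f zero) _ (f (fromℕ (suc n)))))

∑ℕ-cong : ∀ {n} {f g : Fin n → ℕ} → (∀ i → f i ≡ g i) → ∑ℕ f ≡ ∑ℕ g
∑ℕ-cong {zero}  eq = refl
∑ℕ-cong {suc n} eq = cong₂ ℕ._+_ (eq zero) (∑ℕ-cong (eq ∘ suc))

∑ℕ-distrib-+ : ∀ {n} (f g : Fin n → ℕ) → ∑ℕ (λ i → f i ℕ.+ g i) ≡ ∑ℕ f ℕ.+ ∑ℕ g
∑ℕ-distrib-+ {zero}  f g = refl
∑ℕ-distrib-+ {suc n} f g =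
  trans (cong (f zero ℕ.+ g zero ℕ.+_) (∑ℕ-distrib-+ (f ∘ suc) (g ∘ suc)))
        (ℕ+.interchange (f zero) (g zero) (∑ℕ (f ∘ suc)) (∑ℕ (g ∘ suc)))

∑ℕ-zero : ∀ {n} (f : Fin n → ℕ) → (∀ i → f i ≡ 0) → ∑ℕ f ≡ 0
∑ℕ-zero {zero}  f eq = refl
∑ℕ-zero {suc n} f eq = cong₂ ℕ._+_ (eq zero) (∑ℕ-zero (f ∘ suc) (eq ∘ suc))

∑ℕ-point : ∀ {n} (f : Fin n → ℕ) p → (∀ i → i ≢ p → f i ≡ 0) → ∑ℕ f ≡ f p
∑ℕ-point {suc n} f zero    eq =
  trans (cong (f zero ℕ.+_) (∑ℕ-zero (f ∘ suc) (λ i → eq (suc i) λ ()))) (ℕ.+-identityʳ (f zero))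
∑ℕ-point {suc n} f (suc p) eq =
  cong₂ ℕ._+_ (eq zero λ ()) (∑ℕ-point (f ∘ suc) p (λ i i≢p → eq (suc i) (i≢p ∘ suc-injective)))

∑ℕ-comm : ∀ {m n} (f : Fin m → Fin n → ℕ) → ∑ℕ (λ i → ∑ℕ (f i)) ≡ ∑ℕ (λ j → ∑ℕ (λ i → f i j))
∑ℕ-comm {zero}  f = sym (∑ℕ-zero (λ j → ∑ℕ (λ i → f i j)) (λ _ → refl))
∑ℕ-comm {suc m} f =
  trans (cong (∑ℕ (f zero) ℕ.+_) (∑ℕ-comm (f ∘ suc)))
        (sym (∑ℕ-distrib-+ (f zero) (λ j → ∑ℕ (λ i → f (suc i) j))))

search-Fin : ∀ {n} (P : Fin n → Bool) → (∃ λ i → P i ≡ true) ⊎ (∀ i → P i ≡ false)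
search-Fin P with any? (λ i → P i Bool.≟ true)
... | yes found = inj₁ found
... | no none   = inj₂ λ i → ¬-not (λ Pi → none (i , Pi))

from-does : ∀ {A : Set} (a? : Dec A) → does a? ≡ true → A
from-does (yes a) _ = a

anyFin-witness : ∀ {n} (P : Fin n → Bool) → anyFin P ≡ true → ∃ λ i → P i ≡ true
anyFin-witness {suc n} P any with P zero in P0
... | true  = zero , P0
... | false = let (i , Pi) = anyFin-witness (P ∘ suc) any in suc i , Pi

anyFin-intro : ∀ {n} (P : Fin n → Bool) i → P i ≡ true → anyFin P ≡ true
anyFin-intro P zero    Pi = trans (cong (_∨ anyFin (P ∘ suc)) Pi) refl
anyFin-intro P (suc i) Pi = trans (cong (P zero ∨_) (anyFin-intro (P ∘ suc) i Pi)) (∨-zeroʳ (P zero))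

-- A finite index type, given by its ℚ-valued and ℕ-valued sums. `finIndex n` sums with the `∑`, `∑ℕ`
-- of Defs and `I ⊗ J` with the iterated sums, so that `∣_∣`, `numVertF` and the sums in
-- `AffinelyDependent` are, definitionally, sums over `finIndex N` and `finIndex N ⊗ finIndex N`.
record FiniteIndex : Set₁ where
  field
    Ix             : Set
    _≟_            : DecidableEquality Ix
    sum            : (Ix → ℚ) → ℚ
    sum-cong       : ∀ {f g} → (∀ i → f i ≡ g i) → sum f ≡ sum g
    sum-distrib-+  : ∀ f g → sum (λ i → f i + g i) ≡ sum f + sum g
    *-distribˡ-sum : ∀ c f → c * sum f ≡ sum (λ i → c * f i)
    sum-point      : ∀ f p → (∀ i → i ≢ p → f i ≡ 0ℚ) → sum f ≡ f p
    sumℕ           : (Ix → ℕ) → ℕ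
    sumℕ-cong      : ∀ {f g} → (∀ i → f i ≡ g i) → sumℕ f ≡ sumℕ g
    sumℕ-distrib-+ : ∀ f g → sumℕ (λ i → f i ℕ.+ g i) ≡ sumℕ f ℕ.+ sumℕ g
    sumℕ-point     : ∀ f p → (∀ i → i ≢ p → f i ≡ 0) → sumℕ f ≡ f p
    search         : (P : Ix → Bool) → (∃ λ i → P i ≡ true) ⊎ (∀ i → P i ≡ false)

finIndex : ℕ → FiniteIndex
finIndex n = record
  { Ix = Fin n ; _≟_ = Fin._≟_
  ; sum = ∑ ; sum-cong = ∑-cong ; sum-distrib-+ = ∑-distrib-+ ; *-distribˡ-sum = *-distribˡ-∑
  ; sum-point = ∑-point
  ; sumℕ = ∑ℕ ; sumℕ-cong = ∑ℕ-cong ; sumℕ-distrib-+ = ∑ℕ-distrib-+ ; sumℕ-point = ∑ℕ-point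
  ; search = search-Fin }

module FiniteIndexProperties (I : FiniteIndex) where
  open import Data.Rational using (_-_)
  open FiniteIndex I

  sum-zero : ∀ f → (∀ i → f i ≡ 0ℚ) → sum f ≡ 0ℚ
  sum-zero f eq = begin
    sum f                  ≡⟨ sum-cong (λ i → trans (eq i) (sym (ℚ.*-zeroˡ 0ℚ))) ⟩
    sum (λ _ → 0ℚ * 0ℚ)    ≡⟨ sym (*-distribˡ-sum 0ℚ (λ _ → 0ℚ)) ⟩
    0ℚ * sum (λ _ → 0ℚ)    ≡⟨ ℚ.*-zeroˡ (sum (λ _ → 0ℚ)) ⟩
    0ℚ                     ∎
    where open ≡-Reasoning

  *-distribʳ-sum : ∀ c f → sum f * c ≡ sum (λ i → f i * c)
  *-distribʳ-sum c f =
    trans (ℚ.*-comm (sum f) c) (trans (*-distribˡ-sum c f) (sum-cong (λ i → ℚ.*-comm c (f i))))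

  neg-distrib-sum : ∀ f → - sum f ≡ sum (λ i → - f i)
  neg-distrib-sum f = begin
    - sum f
      ≡⟨ cong -_ (sym (ℚ.*-identityˡ (sum f))) ⟩
    - (1ℚ * sum f)
      ≡⟨ ℚ.neg-distribˡ-* 1ℚ (sum f) ⟩
    - 1ℚ * sum f
      ≡⟨ *-distribˡ-sum (- 1ℚ) f ⟩
    sum (λ i → - 1ℚ * f i)
      ≡⟨ sum-cong (λ i → trans (sym (ℚ.neg-distribˡ-* 1ℚ (f i))) (cong -_ (ℚ.*-identityˡ (f i)))) ⟩
    sum (λ i → - f i) ∎
    where open ≡-Reasoning

  sum-distrib-- : ∀ f g → sum (λ i → f i - g i) ≡ sum f - sum g
  sum-distrib-- f g = trans (sum-distrib-+ f (λ i → - g i)) (cong (sum f +_) (sym (neg-distrib-sum g)))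

  sum-comm-∑ : ∀ {n} (f : Ix → Fin n → ℚ) → sum (λ i → ∑ (f i)) ≡ ∑ (λ s → sum (λ i → f i s))
  sum-comm-∑ {zero}  f = sum-zero _ (λ _ → refl)
  sum-comm-∑ {suc n} f =
    trans (sum-distrib-+ _ _) (cong (sum (λ i → f i zero) +_) (sum-comm-∑ (λ i s → f i (suc s))))

  _==_ : Ix → Ix → Bool
  i == j = does (i ≟ j)

  erase : Ix → (Ix → ℚ) → Ix → ℚ
  erase p f i = if p == i then 0ℚ else f i

  sum-erase : ∀ p f → sum f ≡ sum (erase p f) + f p
  sum-erase p f = begin
    sum f
      ≡⟨ sum-cong split ⟩
    sum (λ i → erase p f i + (if p == i then f p else 0ℚ))
      ≡⟨ sum-distrib-+ _ _ ⟩
    sum (erase p f) + sum (λ i → if p == i then f p else 0ℚ)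
      ≡⟨ cong (sum (erase p f) +_) (trans (sum-point _ p off) at-p) ⟩
    sum (erase p f) + f p ∎
    where
    open ≡-Reasoning
    split : ∀ i → f i ≡ erase p f i + (if p == i then f p else 0ℚ)
    split i with p ≟ i
    ... | yes refl = sym (ℚ.+-identityˡ (f i))
    ... | no _     = sym (ℚ.+-identityʳ (f i))
    off : ∀ i → i ≢ p → (if p == i then f p else 0ℚ) ≡ 0ℚ
    off i i≢p rewrite dec-false (p ≟ i) (i≢p ∘ sym) = refl
    at-p : (if p == p then f p else 0ℚ) ≡ f p
    at-p rewrite dec-true (p ≟ p) refl = refl

  erase-other : ∀ p f i → p ≢ i → erase p f i ≡ f i
  erase-other p f i p≢i rewrite dec-false (p ≟ i) p≢i = refl

  unit : Ix → Ix → ℚ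
  unit p i = if p == i then 1ℚ else 0ℚ

  unit-self : ∀ p → unit p p ≡ 1ℚ
  unit-self p rewrite dec-true (p ≟ p) refl = refl

  unit-other : ∀ p i → p ≢ i → unit p i ≡ 0ℚ
  unit-other p i p≢i rewrite dec-false (p ≟ i) p≢i = refl

  sum-unit : ∀ p (f : Ix → ℚ) → sum (λ i → unit p i * f i) ≡ f p
  sum-unit p f = begin
    sum (λ i → unit p i * f i) ≡⟨ sum-point (λ i → unit p i * f i) p off ⟩
    unit p p * f p             ≡⟨ cong (_* f p) (unit-self p) ⟩
    1ℚ * f p                   ≡⟨ ℚ.*-identityˡ (f p) ⟩
    f p                        ∎
    where
    open ≡-Reasoning
    off : ∀ i → i ≢ p → unit p i * f i ≡ 0ℚ
    off i i≢p = trans (cong (_* f i) (unit-other p i (i≢p ∘ sym))) (ℚ.*-zeroˡ (f i))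

  indicator : Bool → ℕ
  indicator b = if b then 1 else 0

  count : (Ix → Bool) → ℕ
  count P = sumℕ (λ i → indicator (P i))

  count-cong : ∀ {P Q} → (∀ i → P i ≡ Q i) → count P ≡ count Q
  count-cong eq = sumℕ-cong (cong indicator ∘ eq)

  sumℕ-zero : ∀ f → (∀ i → f i ≡ 0) → sumℕ f ≡ 0
  sumℕ-zero f eq = trans (sumℕ-cong eq) (ℕ.+-cancelˡ-≡ (sumℕ (λ _ → 0)) _ _ double)
    where
    double : sumℕ (λ _ → 0) ℕ.+ sumℕ (λ _ → 0) ≡ sumℕ (λ _ → 0) ℕ.+ 0
    double = trans (sym (sumℕ-distrib-+ (λ _ → 0) (λ _ → 0))) (sym (ℕ.+-identityʳ _))

  count-empty : ∀ (P : Ix → Bool) → (∀ i → P i ≡ false) → count P ≡ 0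
  count-empty P none = sumℕ-zero _ (cong indicator ∘ none)

  count-split : ∀ (P Q : Ix → Bool) → count P ≡ count (λ i → P i ∧ Q i) ℕ.+ count (λ i → P i ∧ not (Q i))
  count-split P Q = trans (sumℕ-cong pointwise) (sumℕ-distrib-+ _ _)
    where
    pointwise : ∀ i → indicator (P i) ≡ indicator (P i ∧ Q i) ℕ.+ indicator (P i ∧ not (Q i))
    pointwise i with P i | Q i
    ... | true  | true  = refl
    ... | true  | false = refl
    ... | false | _     = refl

  count-point : ∀ p → count (p ==_) ≡ 1
  count-point p = trans (sumℕ-point _ p off) (cong indicator (dec-true (p ≟ p) refl))
    where
    off : ∀ i → i ≢ p → indicator (p == i) ≡ 0
    off i i≢p = cong indicator (dec-false (p ≟ i) (i≢p ∘ sym))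

  _─_ : (Ix → Bool) → Ix → Ix → Bool
  (P ─ p) i = P i ∧ not (p == i)

  ─-⊆ : ∀ P p i → (P ─ p) i ≡ true → P i ≡ true
  ─-⊆ P p i = ∧-conicalˡ (P i) _

  ─-self : ∀ P p → (P ─ p) p ≡ false
  ─-self P p rewrite dec-true (p ≟ p) refl = ∧-zeroʳ (P p)

  ─-cases : ∀ P p i → P i ≡ true → p ≡ i ⊎ (P ─ p) i ≡ true
  ─-cases P p i Pi with p ≟ i
  ... | yes p≡i = inj₁ p≡i
  ... | no _    = inj₂ (trans (cong (_∧ true) Pi) refl)

  ─-false : ∀ P p i → (P ─ p) i ≡ false → p ≡ i ⊎ P i ≡ false
  ─-false P p i i∉ with p ≟ i
  ... | yes p≡i = inj₁ p≡i
  ... | no _    = inj₂ (trans (sym (∧-identityʳ (P i))) i∉)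

  count-remove : ∀ (P : Ix → Bool) p → P p ≡ true → count P ≡ suc (count (P ─ p))
  count-remove P p Pp = begin
    count P
      ≡⟨ count-split P (p ==_) ⟩
    count (λ i → P i ∧ (p == i)) ℕ.+ count (P ─ p)
      ≡⟨ cong (ℕ._+ count (P ─ p)) (trans (count-cong at-p) (count-point p)) ⟩
    suc (count (P ─ p)) ∎
    where
    open ≡-Reasoning
    at-p : ∀ i → P i ∧ (p == i) ≡ (p == i)
    at-p i with p ≟ i
    ... | yes refl = trans (cong (_∧ true) Pp) refl
    ... | no _     = ∧-zeroʳ (P i)

  count-pos : ∀ (P : Ix → Bool) p → P p ≡ true → 1 ≤ count P
  count-pos P p Pp = subst (1 ≤_) (sym (count-remove P p Pp)) (s≤s z≤n)

  count-image : ∀ {m} (f : Fin m → Ix) → (∀ c c′ → f c ≡ f c′ → c ≡ c′) →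
                count (λ i → anyFin (λ c → f c == i)) ≡ m
  count-image {zero}  f _ = count-empty _ (λ _ → refl)
  count-image {suc m} f injective = begin
    count image
      ≡⟨ count-remove image (f zero) (cong (_∨ image′ (f zero)) (dec-true (f zero ≟ f zero) refl)) ⟩
    suc (count (image ─ f zero))
      ≡⟨ cong suc (count-cong rest) ⟩
    suc (count image′)
      ≡⟨ cong suc (count-image (f ∘ suc) (λ c c′ eq → suc-injective (injective _ _ eq))) ⟩
    suc m ∎
    where
    open ≡-Reasoning
    image image′ : Ix → Bool
    image  i = anyFin (λ c → f c == i)
    image′ i = anyFin (λ c → f (suc c) == i)
    not-in-rest : image′ (f zero) ≡ false
    not-in-rest = ¬-not λ found → let (c , fc≡f0) = anyFin-witness _ found in
                    contradiction (injective (suc c) zero (from-does (f (suc c) ≟ f zero) fc≡f0)) λ ()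
    rest : ∀ i → (image ─ f zero) i ≡ image′ i
    rest i with f zero ≟ i
    ... | yes refl = sym not-in-rest
    ... | no _     = ∧-identityʳ (image′ i)

_⊗_ : FiniteIndex → FiniteIndex → FiniteIndex
I ⊗ J = record
  { Ix = I.Ix × J.Ix
  ; _≟_ = ≟-pair
  ; sum = λ f → I.sum (λ i → J.sum (λ j → f (i , j)))
  ; sum-cong = λ eq → I.sum-cong (λ i → J.sum-cong (λ j → eq (i , j)))
  ; sum-distrib-+ = λ f g → trans (I.sum-cong (λ i → J.sum-distrib-+ _ _)) (I.sum-distrib-+ _ _)
  ; *-distribˡ-sum = λ c f → trans (I.*-distribˡ-sum c _) (I.sum-cong (λ i → J.*-distribˡ-sum c _))
  ; sum-point = sum-point
  ; sumℕ = λ f → I.sumℕ (λ i → J.sumℕ (λ j → f (i , j)))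
  ; sumℕ-cong = λ eq → I.sumℕ-cong (λ i → J.sumℕ-cong (λ j → eq (i , j)))
  ; sumℕ-distrib-+ = λ f g → trans (I.sumℕ-cong (λ i → J.sumℕ-distrib-+ _ _)) (I.sumℕ-distrib-+ _ _)
  ; sumℕ-point = sumℕ-point
  ; search = search }
  where
  module I = FiniteIndex I
  module J = FiniteIndex J
  module Jp = FiniteIndexProperties J

  ≟-pair : DecidableEquality (I.Ix × J.Ix)
  ≟-pair (i , j) (i′ , j′) with i I.≟ i′ | j J.≟ j′
  ... | yes refl | yes refl = yes refl
  ... | no i≢i′  | _        = no (i≢i′ ∘ cong proj₁)
  ... | yes _    | no j≢j′  = no (j≢j′ ∘ cong proj₂)

  sum-point : ∀ f p → (∀ x → x ≢ p → f x ≡ 0ℚ) → I.sum (λ i → J.sum (λ j → f (i , j))) ≡ f p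
  sum-point f (p , q) off =
    trans (I.sum-point _ p (λ i i≢p → Jp.sum-zero _ (λ j → off (i , j) (i≢p ∘ cong proj₁))))
          (J.sum-point _ q (λ j j≢q → off (p , j) (j≢q ∘ cong proj₂)))

  sumℕ-point : ∀ f p → (∀ x → x ≢ p → f x ≡ 0) → I.sumℕ (λ i → J.sumℕ (λ j → f (i , j))) ≡ f p
  sumℕ-point f (p , q) off =
    trans (I.sumℕ-point _ p (λ i i≢p → Jp.sumℕ-zero _ (λ j → off (i , j) (i≢p ∘ cong proj₁))))
          (J.sumℕ-point _ q (λ j j≢q → off (p , j) (j≢q ∘ cong proj₂)))

  found : ∀ {A B : Set} → A ⊎ B → Bool
  found (inj₁ _) = true
  found (inj₂ _) = false

  search : (P : I.Ix × J.Ix → Bool) → (∃ λ x → P x ≡ true) ⊎ (∀ x → P x ≡ false)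
  search P with I.search (λ i → found (J.search (λ j → P (i , j))))
  ... | inj₁ (i , _) with J.search (λ j → P (i , j))
  ...   | inj₁ (j , Pij) = inj₁ ((i , j) , Pij)
  search P | inj₁ (i , ()) | inj₂ _
  search P | inj₂ none = inj₂ λ (i , j) → row i (none i) j
    where
    row : ∀ i → found (J.search (λ j → P (i , j))) ≡ false → ∀ j → P (i , j) ≡ false
    row i _ j with J.search (λ j → P (i , j))
    row i () j | inj₁ _
    row i _  j | inj₂ h = h j

Supported : {A : Set} → (A → Bool) → (A → ℚ) → Set
Supported S l = ∀ a → S a ≡ false → l a ≡ 0ℚ

NonTrivial : {A : Set} → (A → ℚ) → Set
NonTrivial l = ∃ λ a → l a ≢ 0ℚ

_⊆ᵇ_ : {A : Set} → (A → Bool) → (A → Bool) → Set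
P ⊆ᵇ Q = ∀ a → P a ≡ true → Q a ≡ true

Supported-mono : ∀ {A : Set} {P Q : A → Bool} {l : A → ℚ} → P ⊆ᵇ Q → Supported P l → Supported Q l
Supported-mono {P = P} P⊆Q supp a a∉Q with P a in a∈P
... | true  = contradiction (trans (sym a∉Q) (P⊆Q a a∈P)) λ ()
... | false = supp a a∈P

*-cancelʳ-nonzero : ∀ x a → a ≢ 0ℚ → x * a ≡ 0ℚ → x ≡ 0ℚ
*-cancelʳ-nonzero x a a≢0 xa≡0 = begin
  x                ≡⟨ sym (ℚ.*-identityʳ x) ⟩
  x * 1ℚ           ≡⟨ cong (x *_) (sym (ℚ.*-inverseʳ a)) ⟩
  x * (a * 1/ a)   ≡⟨ sym (ℚ.*-assoc x a (1/ a)) ⟩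
  (x * a) * 1/ a   ≡⟨ cong (_* 1/ a) xa≡0 ⟩
  0ℚ * 1/ a        ≡⟨ ℚ.*-zeroˡ (1/ a) ⟩
  0ℚ               ∎
  where
  open ≡-Reasoning
  instance _ = ℚ.≢-nonZero a≢0

module GaussianElimination (C R : FiniteIndex) where
  open import Data.Rational using (_-_)
  private
    module C = FiniteIndex C
    module R = FiniteIndex R
  open FiniteIndexProperties C using (erase; sum-erase; erase-other; _─_; ─-⊆; ─-self; ─-cases; unit; unit-self)
    renaming (count to countᶜ; count-remove to countᶜ-remove; count-empty to countᶜ-empty; _==_ to _==ᶜ_)
  open FiniteIndexProperties R using ()
    renaming (count to countʳ; count-remove to countʳ-remove; count-empty to countʳ-empty;
              _─_ to _─ʳ_; ─-⊆ to ─ʳ-⊆; ─-cases to ─ʳ-cases)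
  private module Cp = FiniteIndexProperties C

  Matrix : Set
  Matrix = R.Ix → C.Ix → ℚ

  ⟪_,_⟫ : (C.Ix → ℚ) → (C.Ix → ℚ) → ℚ
  ⟪ l , g ⟫ = C.sum (λ c → l c * g c)

  Solves : (R.Ix → Bool) → Matrix → (C.Ix → ℚ) → Set
  Solves rows M l = ∀ r → rows r ≡ true → ⟪ l , M r ⟫ ≡ 0ℚ

  KernelOrRank : (C.Ix → Bool) → (R.Ix → Bool) → Matrix → Set
  KernelOrRank S rows M =
      (Σ (C.Ix → ℚ) λ l → Supported S l × NonTrivial l × Solves rows M l)
    ⊎ ((∀ l → Supported S l → Solves rows M l → ∀ c → l c ≡ 0ℚ) × countᶜ S ≤ countʳ rows)

  pairing-erase : ∀ p l g → ⟪ l , g ⟫ ≡ ⟪ erase p l , g ⟫ + l p * g p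
  pairing-erase p l g =
    trans (sum-erase p (λ c → l c * g c)) (cong (_+ l p * g p) (C.sum-cong pointwise))
    where
    pointwise : ∀ c → erase p (λ c → l c * g c) c ≡ erase p l c * g c
    pointwise c with p C.≟ c
    ... | yes _ = sym (ℚ.*-zeroˡ (g c))
    ... | no _  = refl

  private
    pairing-zero : ∀ l g → (∀ c → l c ≡ 0ℚ) → ⟪ l , g ⟫ ≡ 0ℚ
    pairing-zero l g l≡0 = Cp.sum-zero _ (λ c → trans (cong (_* g c) (l≡0 c)) (ℚ.*-zeroˡ (g c)))

    no-rows : ∀ S rows M → countʳ rows ≡ 0 → KernelOrRank S rows M
    no-rows S rows M #rows with C.search S
    ... | inj₂ empty =
      inj₂ ((λ l supp _ c → supp c (empty c)) , subst (_≤ countʳ rows) (sym (countᶜ-empty S empty)) z≤n)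
    ... | inj₁ (s , s∈S) = inj₁ (unit s , unit-supported , (s , unit-s) , no-equations)
      where
      unit-supported : Supported S (unit s)
      unit-supported c c∉S with s C.≟ c
      ... | yes refl = contradiction (trans (sym c∉S) s∈S) λ ()
      ... | no _     = refl
      unit-s : unit s s ≢ 0ℚ
      unit-s eq = contradiction (trans (sym (unit-self s)) eq) λ ()
      no-equations : Solves rows M (unit s)
      no-equations r r∈rows = contradiction (trans (sym #rows) (countʳ-remove rows r r∈rows)) λ ()

    drop-row : ∀ S rows M r → rows r ≡ true → (∀ l → Supported S l → ⟪ l , M r ⟫ ≡ 0ℚ) →
               KernelOrRank S (rows ─ʳ r) M → KernelOrRank S rows M
    drop-row S rows M r r∈rows automatic (inj₁ (l , supp , nontrivial , solves)) =
      inj₁ (l , supp , nontrivial , solves′)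
      where
      solves′ : Solves rows M l
      solves′ x x∈rows with ─ʳ-cases rows r x x∈rows
      ... | inj₁ refl      = automatic l supp
      ... | inj₂ x∈rows─r  = solves x x∈rows─r
    drop-row S rows M r r∈rows automatic (inj₂ (trivial , bound)) =
      inj₂ ( (λ l supp solves → trivial l supp (λ x x∈ → solves x (─ʳ-⊆ rows r x x∈)))
           , ℕ.≤-trans bound (subst (countʳ (rows ─ʳ r) ≤_) (sym (countʳ-remove rows r r∈rows)) (ℕ.n≤1+n _)) )

  module Pivot (M : Matrix) (r : R.Ix) (p : C.Ix) (a≢0 : M r p ≢ 0ℚ) where
    private
      a = M r p
      instance _ = ℚ.≢-nonZero a≢0

    multiplier : R.Ix → ℚ
    multiplier x = M x p * 1/ a

    reduced : Matrix
    reduced x c = M x c - multiplier x * M r c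

    private
      pairing-reduced-expand : ∀ l x → ⟪ l , reduced x ⟫ ≡ ⟪ l , M x ⟫ - multiplier x * ⟪ l , M r ⟫
      pairing-reduced-expand l x = begin
        C.sum (λ c → l c * (M x c - multiplier x * M r c))
          ≡⟨ C.sum-cong (λ c → distrib (l c) (M x c) (multiplier x) (M r c)) ⟩
        C.sum (λ c → l c * M x c - multiplier x * (l c * M r c))
          ≡⟨ Cp.sum-distrib-- _ _ ⟩
        ⟪ l , M x ⟫ - C.sum (λ c → multiplier x * (l c * M r c))
          ≡⟨ cong (_-_ ⟪ l , M x ⟫) (sym (C.*-distribˡ-sum (multiplier x) (λ c → l c * M r c))) ⟩
        ⟪ l , M x ⟫ - multiplier x * ⟪ l , M r ⟫ ∎
        where
        open ≡-Reasoning
        distrib : ∀ l m k n → l * (m - k * n) ≡ l * m - k * (l * n)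
        distrib = solve 4 (λ l m k n → l :* (m :- k :* n) := l :* m :- k :* (l :* n)) refl
          where open +-*-Solver

    pairing-reduced : ∀ l x → ⟪ l , M x ⟫ ≡ ⟪ erase p l , reduced x ⟫ + multiplier x * ⟪ l , M r ⟫
    pairing-reduced l x = begin
      ⟪ l , M x ⟫
        ≡⟨ pairing-erase p l (M x) ⟩
      E x + l p * M x p
        ≡⟨ cong (E x +_) (sym (trans (cong (l p * M x p *_) (ℚ.*-inverseˡ a)) (ℚ.*-identityʳ (l p * M x p)))) ⟩
      E x + (l p * M x p) * (1/ a * a)
        ≡⟨ regroup (E x) (E r) (M x p) (1/ a) (l p) a ⟩
      (E x - multiplier x * E r) + multiplier x * (E r + l p * a)
        ≡⟨ cong₂ (λ s t → s + multiplier x * t) (sym (pairing-reduced-expand (erase p l) x))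
                                                (sym (pairing-erase p l (M r))) ⟩
      ⟪ erase p l , reduced x ⟫ + multiplier x * ⟪ l , M r ⟫ ∎
      where
      open ≡-Reasoning
      E : R.Ix → ℚ
      E y = ⟪ erase p l , M y ⟫
      regroup : ∀ X Y m i λp a → X + (λp * m) * (i * a) ≡ (X - (m * i) * Y) + (m * i) * (Y + λp * a)
      regroup = solve 6 (λ X Y m i λp a → X :+ (λp :* m) :* (i :* a)
                                          := (X :- (m :* i) :* Y) :+ (m :* i) :* (Y :+ λp :* a)) refl
        where open +-*-Solver

    lift : ∀ S rows → S p ≡ true → rows r ≡ true →
           KernelOrRank (S ─ p) (rows ─ʳ r) reduced → KernelOrRank S rows M
    lift S rows p∈S r∈rows (inj₁ (μ , supp , (c₀ , μc₀≢0) , solves)) =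
      inj₁ (l , supp-l , (c₀ , l-c₀) , solves-l)
      where
      μp≡0 : μ p ≡ 0ℚ
      μp≡0 = supp p (─-self S p)
      λp : ℚ
      λp = - (⟪ μ , M r ⟫ * 1/ a)
      l : C.Ix → ℚ
      l c = if p ==ᶜ c then λp else μ c
      erase-l : ∀ c → erase p l c ≡ μ c
      erase-l c with p C.≟ c
      ... | yes refl = sym μp≡0
      ... | no _     = refl
      l-p : l p ≡ λp
      l-p rewrite dec-true (p C.≟ p) refl = refl
      row-r : ⟪ l , M r ⟫ ≡ 0ℚ
      row-r = begin
        ⟪ l , M r ⟫
          ≡⟨ pairing-erase p l (M r) ⟩
        ⟪ erase p l , M r ⟫ + l p * a
          ≡⟨ cong₂ (λ s t → s + t * a) (C.sum-cong (λ c → cong (_* M r c) (erase-l c))) l-p ⟩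
        ⟪ μ , M r ⟫ + λp * a
          ≡⟨ cancel ⟪ μ , M r ⟫ (1/ a) a ⟩
        ⟪ μ , M r ⟫ - ⟪ μ , M r ⟫ * (1/ a * a)
          ≡⟨ cong (λ t → ⟪ μ , M r ⟫ - ⟪ μ , M r ⟫ * t) (ℚ.*-inverseˡ a) ⟩
        ⟪ μ , M r ⟫ - ⟪ μ , M r ⟫ * 1ℚ
          ≡⟨ trans (cong (_-_ ⟪ μ , M r ⟫) (ℚ.*-identityʳ ⟪ μ , M r ⟫)) (ℚ.+-inverseʳ ⟪ μ , M r ⟫) ⟩
        0ℚ ∎
        where
        open ≡-Reasoning
        cancel : ∀ Y i a → Y + (- (Y * i)) * a ≡ Y - Y * (i * a)
        cancel = solve 3 (λ Y i a → Y :+ (:- (Y :* i)) :* a := Y :- Y :* (i :* a)) refl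
          where open +-*-Solver
      solves-l : Solves rows M l
      solves-l x x∈rows with ─ʳ-cases rows r x x∈rows
      ... | inj₁ refl = row-r
      ... | inj₂ x∈rows─r = begin
        ⟪ l , M x ⟫
          ≡⟨ pairing-reduced l x ⟩
        ⟪ erase p l , reduced x ⟫ + multiplier x * ⟪ l , M r ⟫
          ≡⟨ cong₂ (λ s t → s + multiplier x * t) (C.sum-cong (λ c → cong (_* reduced x c) (erase-l c))) row-r ⟩
        ⟪ μ , reduced x ⟫ + multiplier x * 0ℚ
          ≡⟨ cong₂ (λ s t → s + t) (solves x x∈rows─r) (ℚ.*-zeroʳ (multiplier x)) ⟩
        0ℚ ∎
        where open ≡-Reasoning
      supp-l : Supported S l
      supp-l c c∉S with p C.≟ c
      ... | yes refl = contradiction (trans (sym c∉S) p∈S) λ ()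
      ... | no _     = supp c (trans (cong (_∧ _) c∉S) refl)
      l-c₀ : l c₀ ≢ 0ℚ
      l-c₀ with p C.≟ c₀
      ... | yes refl = contradiction μp≡0 μc₀≢0
      ... | no _     = μc₀≢0
    lift S rows p∈S r∈rows (inj₂ (trivial , bound)) = inj₂ (trivial′ , bound′)
      where
      trivial′ : ∀ l → Supported S l → Solves rows M l → ∀ c → l c ≡ 0ℚ
      trivial′ l supp solves = l≡0
        where
        μ = erase p l
        supp-μ : Supported (S ─ p) μ
        supp-μ c c∉S─p with p C.≟ c
        ... | yes _ = refl
        ... | no _  = supp c (trans (sym (∧-identityʳ (S c))) c∉S─p)
        solves-μ : Solves (rows ─ʳ r) reduced μ
        solves-μ x x∈ = begin
          ⟪ μ , reduced x ⟫
            ≡⟨ sym (ℚ.+-identityʳ ⟪ μ , reduced x ⟫) ⟩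
          ⟪ μ , reduced x ⟫ + 0ℚ
            ≡⟨ cong (_+_ ⟪ μ , reduced x ⟫)
                    (sym (trans (cong (multiplier x *_) (solves r r∈rows)) (ℚ.*-zeroʳ (multiplier x)))) ⟩
          ⟪ μ , reduced x ⟫ + multiplier x * ⟪ l , M r ⟫
            ≡⟨ sym (pairing-reduced l x) ⟩
          ⟪ l , M x ⟫
            ≡⟨ solves x (─ʳ-⊆ rows r x x∈) ⟩
          0ℚ ∎
          where open ≡-Reasoning
        μ≡0 : ∀ c → μ c ≡ 0ℚ
        μ≡0 = trivial μ supp-μ solves-μ
        lp≡0 : l p ≡ 0ℚ
        lp≡0 = *-cancelʳ-nonzero (l p) a a≢0 (begin
          l p * a                        ≡⟨ sym (ℚ.+-identityˡ (l p * a)) ⟩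
          0ℚ + l p * a                   ≡⟨ cong (_+ l p * a) (sym (pairing-zero μ (M r) μ≡0)) ⟩
          ⟪ μ , M r ⟫ + l p * a          ≡⟨ sym (pairing-erase p l (M r)) ⟩
          ⟪ l , M r ⟫                    ≡⟨ solves r r∈rows ⟩
          0ℚ                             ∎)
          where open ≡-Reasoning
        l≡0 : ∀ c → l c ≡ 0ℚ
        l≡0 c with p C.≟ c
        ... | yes refl = lp≡0
        ... | no p≢c   = trans (sym (erase-other p l c p≢c)) (μ≡0 c)
      bound′ : countᶜ S ≤ countʳ rows
      bound′ = subst₂ _≤_ (sym (countᶜ-remove S p p∈S)) (sym (countʳ-remove rows r r∈rows)) (s≤s bound)

  private
    nonzero? : ℚ → Bool
    nonzero? q = not (does (q ℚ.≟ 0ℚ))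

    fewer-rows : ∀ {rows r n} → rows r ≡ true → countʳ rows ≡ suc n → countʳ (rows ─ʳ r) ≡ n
    fewer-rows {rows} {r} r∈rows #rows = ℕ.suc-injective (trans (sym (countʳ-remove rows r r∈rows)) #rows)

    -- Induction on the number of rows: a row without pivot in S holds for every S-supported
    -- vector and is dropped; otherwise its pivot column is eliminated (`Pivot`).
    elimination : ∀ n S rows M → countʳ rows ≡ n → KernelOrRank S rows M
    elimination zero S rows M #rows = no-rows S rows M #rows
    elimination (suc n) S rows M #rows with R.search rows
    ... | inj₂ empty = contradiction (trans (sym #rows) (countʳ-empty rows empty)) λ ()
    ... | inj₁ (r , r∈rows) with C.search (λ c → S c ∧ nonzero? (M r c))
    ...   | inj₂ no-pivot =
      drop-row S rows M r r∈rows automatic (elimination n S (rows ─ʳ r) M (fewer-rows r∈rows #rows))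
      where
      automatic : ∀ l → Supported S l → ⟪ l , M r ⟫ ≡ 0ℚ
      automatic l supp = Cp.sum-zero _ term
        where
        term : ∀ c → l c * M r c ≡ 0ℚ
        term c with S c in c∈S | M r c ℚ.≟ 0ℚ | no-pivot c
        ... | false | _         | _ = trans (cong (_* M r c) (supp c c∈S)) (ℚ.*-zeroˡ (M r c))
        ... | true  | yes Mrc≡0 | _ = trans (cong (l c *_) Mrc≡0) (ℚ.*-zeroʳ (l c))
        ... | true  | no _      | ()
    ...   | inj₁ (p , pivot) =
      Pivot.lift M r p a≢0 S rows (∧-conicalˡ (S p) _ pivot) r∈rows
        (elimination n (S ─ p) (rows ─ʳ r) (Pivot.reduced M r p a≢0) (fewer-rows r∈rows #rows))
      where
      a≢0 : M r p ≢ 0ℚ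
      a≢0 Mrp≡0 = contradiction pivot-is-false λ ()
        where
        pivot-is-false : true ≡ false
        pivot-is-false = trans (sym pivot)
          (trans (cong (λ b → S p ∧ not b) (dec-true (M r p ℚ.≟ 0ℚ) Mrp≡0)) (∧-zeroʳ (S p)))

  gaussian-elimination : ∀ S rows M → KernelOrRank S rows M
  gaussian-elimination S rows M = elimination (countʳ rows) S rows M refl

  rank-bound : ∀ S rows M → (∀ l → Supported S l → Solves rows M l → ∀ c → l c ≡ 0ℚ) →
               countᶜ S ≤ countʳ rows
  rank-bound S rows M trivial with gaussian-elimination S rows M
  ... | inj₁ (l , supp , (c , lc≢0) , solves) = contradiction (trivial l supp solves c) lc≢0
  ... | inj₂ (_ , bound) = bound

module VectorFamily (I : FiniteIndex) {N : ℕ} (u : FiniteIndex.Ix I → Vecℚ N) where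
  open import Data.Rational using (_-_)
  open FiniteIndex I
  open FiniteIndexProperties I
  private
    module Elimination = GaussianElimination I (finIndex N)
    module Coordinates = FiniteIndexProperties (finIndex N)

  combination : (Ix → ℚ) → Vecℚ N
  combination l k = sum (λ i → l i * u i k)

  Dependent : (Ix → Bool) → Set
  Dependent S = Σ (Ix → ℚ) λ l → Supported S l × NonTrivial l × (∀ k → combination l k ≡ 0ℚ)

  Independent : (Ix → Bool) → Set
  Independent S = ¬ Dependent S

  coordinates : Fin N → Ix → ℚ
  coordinates k i = u i k

  dependent? : ∀ S → Dependent S ⊎ Independent S
  dependent? S with Elimination.gaussian-elimination S (λ _ → true) coordinates
  ... | inj₁ (l , supp , nontrivial , solves) = inj₁ (l , supp , nontrivial , λ k → solves k refl)
  ... | inj₂ (trivial , _) =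
    inj₂ λ (l , supp , (i , li≢0) , l-relation) → li≢0 (trivial l supp (λ k _ → l-relation k) i)

  determining-coordinates-bound : ∀ S (rows : Fin N → Bool) →
    (∀ l → Supported S l → (∀ k → rows k ≡ true → combination l k ≡ 0ℚ) → ∀ i → l i ≡ 0ℚ) →
    count S ≤ Coordinates.count rows
  determining-coordinates-bound S rows = Elimination.rank-bound S rows coordinates

  InSpan : (Ix → Bool) → Vecℚ N → Set
  InSpan S w = Σ (Ix → ℚ) λ μ → Supported S μ × (∀ k → combination μ k ≡ w k)

  span-cong : ∀ {S w w′} → (∀ k → w k ≡ w′ k) → InSpan S w → InSpan S w′
  span-cong w≗w′ (μ , supp , μ-spans) = μ , supp , λ k → trans (μ-spans k) (w≗w′ k)

  span-zero : ∀ S → InSpan S (λ _ → 0ℚ)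
  span-zero S = (λ _ → 0ℚ) , (λ _ _ → refl) , λ k → sum-zero _ (λ i → ℚ.*-zeroˡ (u i k))

  span-+ : ∀ {S w w′} → InSpan S w → InSpan S w′ → InSpan S (λ k → w k + w′ k)
  span-+ {S} {w} {w′} (μ , supp , μ-spans) (μ′ , supp′ , μ′-spans) = (λ i → μ i + μ′ i) , supp″ , spans
    where
    supp″ : Supported S (λ i → μ i + μ′ i)
    supp″ i i∉S = cong₂ _+_ (supp i i∉S) (supp′ i i∉S)
    spans : ∀ k → combination (λ i → μ i + μ′ i) k ≡ w k + w′ k
    spans k = begin
      sum (λ i → (μ i + μ′ i) * u i k)       ≡⟨ sum-cong (λ i → ℚ.*-distribʳ-+ (u i k) (μ i) (μ′ i)) ⟩
      sum (λ i → μ i * u i k + μ′ i * u i k) ≡⟨ sum-distrib-+ _ _ ⟩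
      combination μ k + combination μ′ k     ≡⟨ cong₂ _+_ (μ-spans k) (μ′-spans k) ⟩
      w k + w′ k                             ∎
      where open ≡-Reasoning

  span-neg : ∀ {S w} → InSpan S w → InSpan S (λ k → - w k)
  span-neg {S} {w} (μ , supp , μ-spans) = (λ i → - μ i) , supp′ , spans
    where
    supp′ : Supported S (λ i → - μ i)
    supp′ i i∉S = cong -_ (supp i i∉S)
    spans : ∀ k → combination (λ i → - μ i) k ≡ - w k
    spans k = begin
      sum (λ i → - μ i * u i k)     ≡⟨ sum-cong (λ i → sym (ℚ.neg-distribˡ-* (μ i) (u i k))) ⟩
      sum (λ i → - (μ i * u i k))   ≡⟨ sym (neg-distrib-sum _) ⟩
      - combination μ k             ≡⟨ cong -_ (μ-spans k) ⟩
      - w k                         ∎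
      where open ≡-Reasoning

  span-member : ∀ S x → S x ≡ true → InSpan S (u x)
  span-member S x x∈S = unit x , supp , spans
    where
    supp : Supported S (unit x)
    supp i i∉S with x ≟ i
    ... | yes refl = contradiction (trans (sym i∉S) x∈S) λ ()
    ... | no _     = refl
    spans : ∀ k → combination (unit x) k ≡ u x k
    spans k = sum-unit x (λ i → u i k)

  combination-of-units : ∀ {m} (o : Fin m → Ix) (ε : Fin m → ℚ) k →
    combination (λ i → ∑ (λ s → ε s * unit (o s) i)) k ≡ ∑ (λ s → ε s * u (o s) k)
  combination-of-units {m} o ε k = begin
    sum (λ i → ∑ (λ s → ε s * unit (o s) i) * u i k)
      ≡⟨ sum-cong (λ i → Fm.*-distribʳ-sum (u i k) _) ⟩
    sum (λ i → ∑ (λ s → (ε s * unit (o s) i) * u i k))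
      ≡⟨ sum-comm-∑ (λ i s → (ε s * unit (o s) i) * u i k) ⟩
    ∑ (λ s → sum (λ i → (ε s * unit (o s) i) * u i k))
      ≡⟨ ∑-cong (λ s → sum-cong (λ i → ℚ.*-assoc (ε s) _ (u i k))) ⟩
    ∑ (λ s → sum (λ i → ε s * (unit (o s) i * u i k)))
      ≡⟨ ∑-cong (λ s → sym (*-distribˡ-sum (ε s) _)) ⟩
    ∑ (λ s → ε s * sum (λ i → unit (o s) i * u i k))
      ≡⟨ ∑-cong (λ s → cong (ε s *_) (sum-unit (o s) (λ i → u i k))) ⟩
    ∑ (λ s → ε s * u (o s) k) ∎
    where
    open ≡-Reasoning
    module Fm = FiniteIndexProperties (finIndex m)

  span-mono : ∀ {S S′ w} → S ⊆ᵇ S′ → InSpan S w → InSpan S′ w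
  span-mono S⊆S′ (μ , supp , μ-spans) = μ , Supported-mono S⊆S′ supp , μ-spans

  insert : Ix → (Ix → Bool) → Ix → Bool
  insert x S i = S i ∨ (x == i)

  span-of-dependent-insert : ∀ S x → Independent S → Dependent (insert x S) → InSpan S (u x)
  span-of-dependent-insert S x independent (l , supp , nontrivial , l-relation) = μ , supp-μ , spans
    where
    outside : ∀ i → S i ≡ false → x ≢ i → l i ≡ 0ℚ
    outside i i∉S x≢i = supp i (trans (cong (_∨ (x == i)) i∉S) (dec-false (x ≟ i) x≢i))
    lx≢0 : l x ≢ 0ℚ
    lx≢0 lx≡0 = independent (l , supp-S , nontrivial , l-relation)
      where
      supp-S : Supported S l
      supp-S i i∉S with x ≟ i
      ... | yes refl = lx≡0
      ... | no x≢i   = outside i i∉S x≢i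
    instance _ = ℚ.≢-nonZero lx≢0
    μ : Ix → ℚ
    μ i = - (1/ l x * erase x l i)
    scaled-zero : ∀ {t} → t ≡ 0ℚ → - (1/ l x * t) ≡ 0ℚ
    scaled-zero refl = cong -_ (ℚ.*-zeroʳ (1/ l x))
    supp-μ : Supported S μ
    supp-μ i i∉S with x ≟ i
    ... | yes refl = scaled-zero refl
    ... | no x≢i   = scaled-zero (outside i i∉S x≢i)
    spans : ∀ k → combination μ k ≡ u x k
    spans k = begin
      sum (λ i → - (1/ l x * erase x l i) * u i k)
        ≡⟨ sum-cong (λ i → regroup (1/ l x) (erase x l i) (u i k)) ⟩
      sum (λ i → - (1/ l x * (erase x l i * u i k)))
        ≡⟨ sym (neg-distrib-sum _) ⟩
      - sum (λ i → 1/ l x * (erase x l i * u i k))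
        ≡⟨ cong -_ (sym (*-distribˡ-sum (1/ l x) _)) ⟩
      - (1/ l x * Y)
        ≡⟨ cong (λ t → - (1/ l x * t)) Y≡ ⟩
      - (1/ l x * - (l x * u x k))
        ≡⟨ cancel (1/ l x) (l x) (u x k) ⟩
      (1/ l x * l x) * u x k
        ≡⟨ cong (_* u x k) (ℚ.*-inverseˡ (l x)) ⟩
      1ℚ * u x k
        ≡⟨ ℚ.*-identityˡ (u x k) ⟩
      u x k ∎
      where
      open ≡-Reasoning
      open +-*-Solver
      Y : ℚ
      Y = sum (λ i → erase x l i * u i k)
      regroup : ∀ c e v → - (c * e) * v ≡ - (c * (e * v))
      regroup = solve 3 (λ c e v → (:- (c :* e)) :* v := :- (c :* (e :* v))) refl
      cancel : ∀ c a v → - (c * - (a * v)) ≡ (c * a) * v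
      cancel = solve 3 (λ c a v → :- (c :* (:- (a :* v))) := (c :* a) :* v) refl
      solve-for : ∀ y z → y + z ≡ 0ℚ → y ≡ - z
      solve-for y z y+z≡0 = begin
        y               ≡⟨ solve 2 (λ y z → y := (y :+ z) :+ (:- z)) refl y z ⟩
        (y + z) + - z   ≡⟨ cong (_+ - z) y+z≡0 ⟩
        0ℚ + - z        ≡⟨ ℚ.+-identityˡ (- z) ⟩
        - z             ∎
      Y≡ : Y ≡ - (l x * u x k)
      Y≡ = solve-for Y (l x * u x k) (trans (sym (Elimination.pairing-erase x l (coordinates k))) (l-relation k))

  MaximalIndependentIn : (Ix → Bool) → (Ix → Bool) → Set
  MaximalIndependentIn F B = B ⊆ᵇ F × Independent B × (∀ i → F i ≡ true → InSpan B (u i))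

  private
    greedy : ∀ n F (pending B : Ix → Bool) → count pending ≡ n → pending ⊆ᵇ F → B ⊆ᵇ F → Independent B →
             (∀ i → F i ≡ true → pending i ≡ false → InSpan B (u i)) → Σ (Ix → Bool) (MaximalIndependentIn F)
    greedy zero F pending B #pending _ B⊆F independent spans =
      B , B⊆F , independent , λ i i∈F → spans i i∈F (¬-not λ i∈pending →
        contradiction (trans (sym #pending) (count-remove pending i i∈pending)) λ ())
    greedy (suc n) F pending B #pending pending⊆F B⊆F independent spans with search pending
    ... | inj₂ none = contradiction (trans (sym #pending) (count-empty pending none)) λ ()
    ... | inj₁ (x , x∈pending) = consider (dependent? (insert x B))
      where
      #pending─x : count (pending ─ x) ≡ n
      #pending─x = ℕ.suc-injective (trans (sym (count-remove pending x x∈pending)) #pending)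
      pending─x⊆F : (pending ─ x) ⊆ᵇ F
      pending─x⊆F i i∈ = pending⊆F i (─-⊆ pending x i i∈)
      B⊆B+x : B ⊆ᵇ insert x B
      B⊆B+x i i∈B = cong (_∨ (x == i)) i∈B
      B+x⊆F : insert x B ⊆ᵇ F
      B+x⊆F i i∈ with B i in i∈B | x ≟ i
      ... | true  | _        = B⊆F i i∈B
      ... | false | yes refl = pending⊆F i x∈pending
      ... | false | no _     = contradiction i∈ λ ()

      consider : Dependent (insert x B) ⊎ Independent (insert x B) → Σ (Ix → Bool) (MaximalIndependentIn F)
      consider (inj₁ dependent) = greedy n F (pending ─ x) B #pending─x pending─x⊆F B⊆F independent spans′
        where
        spans′ : ∀ i → F i ≡ true → (pending ─ x) i ≡ false → InSpan B (u i)
        spans′ i i∈F i∉ with ─-false pending x i i∉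
        ... | inj₁ refl        = span-of-dependent-insert B x independent dependent
        ... | inj₂ i∉pending   = spans i i∈F i∉pending
      consider (inj₂ independent′) =
        greedy n F (pending ─ x) (insert x B) #pending─x pending─x⊆F B+x⊆F independent′ spans′
        where
        spans′ : ∀ i → F i ≡ true → (pending ─ x) i ≡ false → InSpan (insert x B) (u i)
        spans′ i i∈F i∉ with ─-false pending x i i∉
        ... | inj₁ refl        = span-member (insert x B) x (trans (cong (B x ∨_) (dec-true (x ≟ x) refl)) (∨-zeroʳ (B x)))
        ... | inj₂ i∉pending   = span-mono B⊆B+x (spans i i∈F i∉pending)

  maximal-independent : ∀ F → Σ (Ix → Bool) (MaximalIndependentIn F)
  maximal-independent F =
    greedy (count F) F F (λ _ → false) refl (λ _ i∈F → i∈F) (λ _ ()) empty-independent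
           (λ i i∈F i∉F → contradiction (trans (sym i∉F) i∈F) λ ())
    where
    empty-independent : Independent (λ _ → false)
    empty-independent (l , supp , (i , li≢0) , _) = li≢0 (supp i refl)

  -- Steinitz exchange, by elimination on the matrix of spanning coefficients.
  span-count : ∀ {m} (w : Fin m → Vecℚ N) (T : Fin m → Bool) (S : Ix → Bool) →
    (∀ j → T j ≡ true → InSpan S (w j)) →
    (∀ ν → Supported T ν → (∀ k → ∑ (λ j → ν j * w j k) ≡ 0ℚ) → ∀ j → ν j ≡ 0ℚ) →
    FiniteIndexProperties.count (finIndex m) T ≤ count S
  span-count {m} w T S spans w-independent = Elim.rank-bound T S coefficients trivial
    where
    module Elim = GaussianElimination (finIndex m) I
    module Fm = FiniteIndexProperties (finIndex m)
    coefficient : ∀ j b → T j ≡ b → Ix → ℚ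
    coefficient j true  Tj = proj₁ (spans j Tj)
    coefficient j false _  = λ _ → 0ℚ
    coefficients : Ix → Fin m → ℚ
    coefficients i j = coefficient j (T j) refl i
    coefficient-outside : ∀ i → S i ≡ false → ∀ j b (e : T j ≡ b) → coefficient j b e i ≡ 0ℚ
    coefficient-outside i i∉S j true  Tj = proj₁ (proj₂ (spans j Tj)) i i∉S
    coefficient-outside i i∉S j false _  = refl
    expand : ∀ ν → Supported T ν → ∀ k j b (e : T j ≡ b) →
             ν j * w j k ≡ sum (λ i → (ν j * coefficient j b e i) * u i k)
    expand ν supp k j true Tj = begin
      ν j * w j k                                   ≡⟨ cong (ν j *_) (sym (proj₂ (proj₂ (spans j Tj)) k)) ⟩
      ν j * sum (λ i → μ i * u i k)                 ≡⟨ *-distribˡ-sum (ν j) _ ⟩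
      sum (λ i → ν j * (μ i * u i k))               ≡⟨ sum-cong (λ i → sym (ℚ.*-assoc (ν j) (μ i) (u i k))) ⟩
      sum (λ i → (ν j * μ i) * u i k)               ∎
      where
      open ≡-Reasoning
      μ = proj₁ (spans j Tj)
    expand ν supp k j false Tj = begin
      ν j * w j k
        ≡⟨ cong (_* w j k) (supp j Tj) ⟩
      0ℚ * w j k
        ≡⟨ ℚ.*-zeroˡ (w j k) ⟩
      0ℚ
        ≡⟨ sym (sum-zero _ (λ i → trans (cong (λ t → t * 0ℚ * u i k) (supp j Tj)) (ℚ.*-zeroˡ (u i k)))) ⟩
      sum (λ i → (ν j * 0ℚ) * u i k) ∎
      where open ≡-Reasoning
    trivial : ∀ ν → Supported T ν → Elim.Solves S coefficients ν → ∀ j → ν j ≡ 0ℚ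
    trivial ν supp solves = w-independent ν supp relation
      where
      pairing-zero : ∀ i → ∑ (λ j → ν j * coefficients i j) ≡ 0ℚ
      pairing-zero i with S i in i∈S
      ... | true  = solves i i∈S
      ... | false = ∑-zero _ (λ j → trans (cong (ν j *_) (coefficient-outside i i∈S j (T j) refl)) (ℚ.*-zeroʳ (ν j)))
      relation : ∀ k → ∑ (λ j → ν j * w j k) ≡ 0ℚ
      relation k = begin
        ∑ (λ j → ν j * w j k)
          ≡⟨ ∑-cong (λ j → expand ν supp k j (T j) refl) ⟩
        ∑ (λ j → sum (λ i → (ν j * coefficients i j) * u i k))
          ≡⟨ sym (sum-comm-∑ (λ i j → (ν j * coefficients i j) * u i k)) ⟩
        sum (λ i → ∑ (λ j → (ν j * coefficients i j) * u i k))
          ≡⟨ sum-cong (λ i → sym (Fm.*-distribʳ-sum (u i k) (λ j → ν j * coefficients i j))) ⟩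
        sum (λ i → ∑ (λ j → ν j * coefficients i j) * u i k)
          ≡⟨ sum-zero _ (λ i → trans (cong (_* u i k) (pairing-zero i)) (ℚ.*-zeroˡ (u i k))) ⟩
        0ℚ ∎
        where open ≡-Reasoning

Consec-functional : ∀ {m s t t′} → Consec m s t → Consec m s t′ → t ≡ t′
Consec-functional (inj₁ t≡s+1) (inj₁ t′≡s+1) = toℕ-injective (trans t≡s+1 (sym t′≡s+1))
Consec-functional {t = t} (inj₁ t≡s+1) (inj₂ (s+1≡m , _)) = contradiction (trans t≡s+1 s+1≡m) (ℕ.<⇒≢ (toℕ<n t))
Consec-functional {t′ = t′} (inj₂ (s+1≡m , _)) (inj₁ t′≡s+1) =
  contradiction (trans t′≡s+1 s+1≡m) (ℕ.<⇒≢ (toℕ<n t′))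
Consec-functional (inj₂ (_ , t≡0)) (inj₂ (_ , t′≡0)) = toℕ-injective (trans t≡0 (sym t′≡0))

Consec-injective : ∀ {m s s′ t} → Consec m s t → Consec m s′ t → s ≡ s′
Consec-injective (inj₁ t≡s+1) (inj₁ t≡s′+1) = toℕ-injective (ℕ.suc-injective (trans (sym t≡s+1) t≡s′+1))
Consec-injective (inj₁ t≡s+1) (inj₂ (_ , t≡0)) = contradiction (trans (sym t≡s+1) t≡0) λ ()
Consec-injective (inj₂ (_ , t≡0)) (inj₁ t≡s′+1) = contradiction (trans (sym t≡s′+1) t≡0) λ ()
Consec-injective (inj₂ (s+1≡m , _)) (inj₂ (s′+1≡m , _)) = toℕ-injective (ℕ.suc-injective (trans s+1≡m (sym s′+1≡m)))

Consec-asymmetric : ∀ {m s t} → 3 ≤ m → Consec m s t → ¬ Consec m t s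
Consec-asymmetric {s = s} _ (inj₁ t≡s+1) (inj₁ s≡t+1) =
  ℕ.<⇒≢ (ℕ.<-trans (ℕ.n<1+n (toℕ s)) (ℕ.n<1+n _)) (trans s≡t+1 (cong suc t≡s+1))
Consec-asymmetric 3≤m (inj₁ t≡s+1) (inj₂ (t+1≡m , s≡0)) =
  ℕ.<⇒≢ 3≤m (sym (trans (sym t+1≡m) (cong suc (trans t≡s+1 (cong suc s≡0)))))
Consec-asymmetric 3≤m (inj₂ (s+1≡m , t≡0)) (inj₁ s≡t+1) =
  ℕ.<⇒≢ 3≤m (sym (trans (sym s+1≡m) (cong suc (trans s≡t+1 (cong suc t≡0)))))
Consec-asymmetric 3≤m (inj₂ (s+1≡m , t≡0)) (inj₂ (_ , s≡0)) =
  ℕ.<⇒≢ (ℕ.≤-trans (s≤s (s≤s z≤n)) 3≤m) (sym (trans (sym s+1≡m) (cong suc s≡0)))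

module CyclicOrder {n : ℕ} where

  next : Fin (suc n) → Fin (suc n)
  next s with suc (toℕ s) ℕ.<? suc n
  ... | yes s+1<m = fromℕ< s+1<m
  ... | no _      = zero

  Consec-next : ∀ s → Consec (suc n) s (next s)
  Consec-next s with suc (toℕ s) ℕ.<? suc n
  ... | yes s+1<m = inj₁ (toℕ-fromℕ< s+1<m)
  ... | no  s+1≮m = inj₂ (ℕ.≤-antisym (toℕ<n s) (ℕ.≮⇒≥ s+1≮m) , refl)

  Consec⇒next : ∀ {s t} → Consec (suc n) s t → t ≡ next s
  Consec⇒next c = Consec-functional c (Consec-next _)

  prev : Fin (suc n) → Fin (suc n)
  prev zero    = fromℕ n
  prev (suc s) = inject₁ s

  Consec-prev : ∀ s → Consec (suc n) (prev s) s
  Consec-prev zero    = inj₂ (cong suc (toℕ-fromℕ n) , refl)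
  Consec-prev (suc s) = inj₁ (cong suc (sym (toℕ-inject₁ s)))

  next-prev : ∀ s → next (prev s) ≡ s
  next-prev s = sym (Consec⇒next (Consec-prev s))

  prev-next : ∀ s → prev (next s) ≡ s
  prev-next s = Consec-injective (Consec-prev (next s)) (Consec-next s)

  ∑-next : ∀ (g : Fin (suc n) → ℚ) → ∑ (g ∘ next) ≡ ∑ g
  ∑-next g = begin
    ∑ (g ∘ next)
      ≡⟨ ∑-init-last (g ∘ next) ⟩
    ∑ (g ∘ next ∘ inject₁) + g (next (fromℕ n))
      ≡⟨ cong₂ _+_ (∑-cong (λ s → cong g (next-inject₁ s))) (cong g next-last) ⟩
    ∑ (g ∘ suc) + g zero
      ≡⟨ ℚ.+-comm _ (g zero) ⟩
    ∑ g ∎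
    where
    open ≡-Reasoning
    next-inject₁ : ∀ s → next (inject₁ s) ≡ suc s
    next-inject₁ s = sym (Consec⇒next (inj₁ (cong suc (sym (toℕ-inject₁ s)))))
    next-last : next (fromℕ n) ≡ zero
    next-last = sym (Consec⇒next (inj₂ (cong suc (toℕ-fromℕ n) , refl)))

  cyclic-invariant : (P : Fin (suc n) → Set) → (∀ s → P s → P (next s)) → (∀ s → P (next s) → P s) →
                     ∀ {s₀} → P s₀ → ∀ s → P s
  cyclic-invariant P forward backward {s₀} Ps₀ s = up (toℕ s) s refl
    where
    toℕ-prev : ∀ s {d} → toℕ s ≡ suc d → toℕ (prev s) ≡ d
    toℕ-prev (suc s) eq = trans (toℕ-inject₁ s) (ℕ.suc-injective eq)
    down : ∀ d s → toℕ s ≡ d → P s → P zero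
    down zero    s eq Ps = subst P (toℕ-injective eq) Ps
    down (suc d) s eq Ps = down d (prev s) (toℕ-prev s eq) (backward (prev s) (subst P (sym (next-prev s)) Ps))
    up : ∀ d s → toℕ s ≡ d → P s
    up zero    s eq = subst P (sym (toℕ-injective eq)) (down (toℕ s₀) s₀ refl Ps₀)
    up (suc d) s eq = subst P (next-prev s) (forward (prev s) (up d (prev s) (toℕ-prev s eq)))

module _ {A : Set} (_≟_ : DecidableEquality A) (f : ℕ → A) where

  RepetitionFreeLoop : Set
  RepetitionFreeLoop = ∃₂ λ a g → 1 ≤ g × f a ≡ f (a ℕ.+ g) ×
                         (∀ s t → s < g → t < g → f (a ℕ.+ s) ≡ f (a ℕ.+ t) → s ≡ t)

  private
    shorten : ∀ g → Acc _<_ g → ∀ a → 1 ≤ g → f a ≡ f (a ℕ.+ g) → RepetitionFreeLoop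
    shorten g (acc shorter) a 1≤g loop
      with any? (λ (s : Fin g) → any? (λ (t : Fin g) →
             (toℕ s ℕ.<? toℕ t) ×-dec (f (a ℕ.+ toℕ s) ≟ f (a ℕ.+ toℕ t))))
    ... | yes (s , t , s<t , repeat) =
      shorten (toℕ t ∸ toℕ s) (shorter (ℕ.≤-<-trans (ℕ.m∸n≤m (toℕ t) (toℕ s)) (toℕ<n t))) (a ℕ.+ toℕ s)
              (ℕ.m<n⇒0<n∸m s<t)
              (trans repeat (cong f (trans (cong (a ℕ.+_) (sym (ℕ.m+[n∸m]≡n (ℕ.<⇒≤ s<t))))
                                           (sym (ℕ.+-assoc a (toℕ s) _)))))
    ... | no no-repeat = a , g , 1≤g , loop , injective
      where
      ordered : ∀ s t → s < g → t < g → s < t → f (a ℕ.+ s) ≢ f (a ℕ.+ t)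
      ordered s t s<g t<g s<t repeat =
        no-repeat (fromℕ< s<g , fromℕ< t<g , subst₂ _<_ (sym (toℕ-fromℕ< s<g)) (sym (toℕ-fromℕ< t<g)) s<t ,
                   subst₂ (λ x y → f (a ℕ.+ x) ≡ f (a ℕ.+ y)) (sym (toℕ-fromℕ< s<g)) (sym (toℕ-fromℕ< t<g)) repeat)
      injective : ∀ s t → s < g → t < g → f (a ℕ.+ s) ≡ f (a ℕ.+ t) → s ≡ t
      injective s t s<g t<g repeat with ℕ.<-cmp s t
      ... | tri< s<t _ _ = contradiction repeat (ordered s t s<g t<g s<t)
      ... | tri≈ _ s≡t _ = s≡t
      ... | tri> _ _ t<s = contradiction (sym repeat) (ordered t s t<g s<g t<s)

  repetition-free-loop : ∀ a g → 1 ≤ g → f a ≡ f (a ℕ.+ g) → RepetitionFreeLoop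
  repetition-free-loop a g = shorten g (<-wellFounded g) a

EdgeF-sym : ∀ {N} (A : PairSet N) u v → EdgeF A u v ≡ true → EdgeF A v u ≡ true
EdgeF-sym A u v e = trans (∨-comm (A v u) (A u v)) e

EdgeF-cases : ∀ {N} (A : PairSet N) u v → EdgeF A u v ≡ true → A u v ≡ true ⊎ A v u ≡ true
EdgeF-cases A u v e with A u v
... | true  = inj₁ refl
... | false = inj₂ e

NoDeadEnds : ∀ {N} → PairSet N → Set
NoDeadEnds {N} A = ∀ u v → EdgeF A u v ≡ true → ∃ λ w → w ≢ v × EdgeF A u w ≡ true

module _ {N : ℕ} (A : PairSet N) (loopless : ∀ u → EdgeF A u u ≡ false) (no-dead-ends : NoDeadEnds A) where

  private
    Step : Set
    Step = Σ (Fin N × Fin N) λ (u , v) → EdgeF A u v ≡ true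

    advance : Step → Step
    advance ((u , v) , uv) = let (w , w≢u , vw) = no-dead-ends v u (EdgeF-sym A u v uv) in (v , w) , vw

  -- A walk without backtracking repeats a vertex by pigeonhole, and its shortest repetition is
  -- a cycle of length at least 3.
  cycle-from-edge : ∀ u v → EdgeF A u v ≡ true → HasCycle A
  cycle-from-edge u₀ v₀ e₀ = g , 3≤g , cycle , cycle-injective , cycle-edges
    where
    walk : ℕ → Step
    walk zero    = (u₀ , v₀) , e₀
    walk (suc t) = advance (walk t)

    position : ℕ → Fin N
    position t = proj₁ (proj₁ (walk t))

    consecutive : ∀ t → EdgeF A (position t) (position (suc t)) ≡ true
    consecutive t = proj₂ (walk t)

    no-backtracking : ∀ t → position (suc (suc t)) ≢ position t
    no-backtracking t = proj₁ (proj₂ (no-dead-ends _ _ (EdgeF-sym A _ _ (consecutive t))))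

    repeat = pigeonhole (ℕ.n<1+n N) (λ (i : Fin (suc N)) → position (toℕ i))
    i = proj₁ repeat
    j = proj₁ (proj₂ repeat)
    i<j = proj₁ (proj₂ (proj₂ repeat))

    loop : RepetitionFreeLoop Fin._≟_ position
    loop = repetition-free-loop Fin._≟_ position (toℕ i) (toℕ j ∸ toℕ i) (ℕ.m<n⇒0<n∸m i<j)
             (trans (proj₂ (proj₂ (proj₂ repeat))) (cong position (sym (ℕ.m+[n∸m]≡n (ℕ.<⇒≤ i<j)))))
    a = proj₁ loop
    g = proj₁ (proj₂ loop)
    closed : position a ≡ position (a ℕ.+ g)
    closed = proj₁ (proj₂ (proj₂ (proj₂ loop)))
    distinct = proj₂ (proj₂ (proj₂ (proj₂ loop)))

    3≤g : 3 ≤ g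
    3≤g with g | closed | proj₁ (proj₂ (proj₂ loop))
    ... | 1 | closed | _ = contradiction (trans (sym (loopless (position a))) loop-edge) λ ()
      where
      loop-edge : EdgeF A (position a) (position a) ≡ true
      loop-edge = subst (λ x → EdgeF A (position a) x ≡ true) (sym (trans closed (cong position (ℕ.+-comm a 1)))) (consecutive a)
    ... | 2 | closed | _ = contradiction (sym (trans closed (cong position (ℕ.+-comm a 2)))) (no-backtracking a)
    ... | suc (suc (suc _)) | _ | _ = s≤s (s≤s (s≤s z≤n))

    cycle : Fin g → Fin N
    cycle s = position (a ℕ.+ toℕ s)

    cycle-injective : InjectiveSeq cycle
    cycle-injective s t eq = toℕ-injective (distinct (toℕ s) (toℕ t) (toℕ<n s) (toℕ<n t) eq)

    successor : ∀ {s t} → Consec g s t → cycle t ≡ position (suc (a ℕ.+ toℕ s))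
    successor {s} (inj₁ t≡s+1) = cong position (trans (cong (a ℕ.+_) t≡s+1) (ℕ.+-suc a (toℕ s)))
    successor {s} (inj₂ (s+1≡g , t≡0)) = begin
      position (a ℕ.+ toℕ _)       ≡⟨ cong (λ x → position (a ℕ.+ x)) t≡0 ⟩
      position (a ℕ.+ 0)           ≡⟨ cong position (ℕ.+-identityʳ a) ⟩
      position a                 ≡⟨ closed ⟩
      position (a ℕ.+ g)           ≡⟨ cong position (trans (cong (a ℕ.+_) (sym s+1≡g)) (ℕ.+-suc a (toℕ s))) ⟩
      position (suc (a ℕ.+ toℕ s)) ∎
      where open ≡-Reasoning

    cycle-edges : ∀ s t → Consec g s t → EdgeF A (cycle s) (cycle t) ≡ true
    cycle-edges s t c = subst (λ x → EdgeF A (cycle s) x ≡ true) (sym (successor c)) (consecutive (a ℕ.+ toℕ s))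

HasCycle-mono : ∀ {N} {A B : PairSet N} → (∀ u v → EdgeF A u v ≡ true → EdgeF B u v ≡ true) →
                HasCycle A → HasCycle B
HasCycle-mono A⊆B (m , 3≤m , v , injective , edges) = m , 3≤m , v , injective , λ s t c → A⊆B _ _ (edges s t c)

pairs : ℕ → FiniteIndex
pairs N = finIndex N ⊗ finIndex N

e-self : ∀ {N} (i : Fin N) → e i i ≡ 1ℚ
e-self i with i Fin.≟ i
... | yes _   = refl
... | no i≢i = contradiction refl i≢i

e-other : ∀ {N} (i k : Fin N) → i ≢ k → e i k ≡ 0ℚ
e-other i k i≢k with i Fin.≟ k
... | yes i≡k = contradiction i≡k i≢k
... | no _    = refl

root-antisym : ∀ {N} (i j k : Fin N) → root j i k ≡ - root i j k
root-antisym i j k = solve 2 (λ x y → y :- x := :- (x :- y)) refl (e i k) (e j k)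
  where open +-*-Solver

module Roots (N : ℕ) where
  open import Data.Rational using (_-_)
  open FiniteIndex (pairs N) using (sum; sum-cong)
  open FiniteIndexProperties (pairs N) using (sum-comm-∑)
  open VectorFamily (pairs N) (uncurry root) public

  outflow inflow : (Fin N × Fin N → ℚ) → Fin N → ℚ
  outflow l u = ∑ (λ b → l (u , b))
  inflow  l u = ∑ (λ a → l (a , u))

  combination-net-flow : ∀ l u → combination l u ≡ outflow l u - inflow l u
  combination-net-flow l u = begin
    ∑ (λ a → ∑ (λ b → l (a , b) * (e a u - e b u)))
      ≡⟨ ∑-cong (λ a → ∑-cong (λ b → distrib (l (a , b)) (e a u) (e b u))) ⟩
    ∑ (λ a → ∑ (λ b → l (a , b) * e a u - l (a , b) * e b u))
      ≡⟨ ∑-cong (λ a → sum-distrib-- (λ b → l (a , b) * e a u) (λ b → l (a , b) * e b u)) ⟩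
    ∑ (λ a → ∑ (λ b → l (a , b) * e a u) - ∑ (λ b → l (a , b) * e b u))
      ≡⟨ sum-distrib-- (λ a → ∑ (λ b → l (a , b) * e a u)) (λ a → ∑ (λ b → l (a , b) * e b u)) ⟩
    ∑ (λ a → ∑ (λ b → l (a , b) * e a u)) - ∑ (λ a → ∑ (λ b → l (a , b) * e b u))
      ≡⟨ cong₂ _-_ out in′ ⟩
    outflow l u - inflow l u ∎
    where
    open ≡-Reasoning
    open FiniteIndexProperties (finIndex N) using (sum-distrib--)
    distrib : ∀ x y z → x * (y - z) ≡ x * y - x * z
    distrib = solve 3 (λ x y z → x :* (y :- z) := x :* y :- x :* z) refl
      where open +-*-Solver
    at-u : ∀ a b → l (a , b) * e u u ≡ l (a , b)
    at-u a b = trans (cong (l (a , b) *_) (e-self u)) (ℚ.*-identityʳ (l (a , b)))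
    off-u : ∀ a b x → x ≢ u → l (a , b) * e x u ≡ 0ℚ
    off-u a b x x≢u = trans (cong (l (a , b) *_) (e-other x u x≢u)) (ℚ.*-zeroʳ (l (a , b)))
    out : ∑ (λ a → ∑ (λ b → l (a , b) * e a u)) ≡ outflow l u
    out = trans (∑-point _ u (λ a a≢u → ∑-zero _ (λ b → off-u a b a a≢u))) (∑-cong (at-u u))
    in′ : ∑ (λ a → ∑ (λ b → l (a , b) * e b u)) ≡ inflow l u
    in′ = ∑-cong (λ a → trans (∑-point _ u (λ b → off-u a b b)) (at-u a u))

  ∑-weighted-e : ∀ (φ : Fin N → ℚ) a → ∑ (λ u → φ u * e a u) ≡ φ a
  ∑-weighted-e φ a = trans (∑-point (λ u → φ u * e a u) a off) (trans (cong (φ a *_) (e-self a)) (ℚ.*-identityʳ (φ a)))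
    where
    off : ∀ u → u ≢ a → φ u * e a u ≡ 0ℚ
    off u u≢a = trans (cong (φ u *_) (e-other a u (u≢a ∘ sym))) (ℚ.*-zeroʳ (φ u))

  ·-root : ∀ (φ : Fin N → ℚ) a b → φ · root a b ≡ φ a - φ b
  ·-root φ a b = begin
    ∑ (λ u → φ u * (e a u - e b u))                  ≡⟨ ∑-cong (λ u → distrib (φ u) (e a u) (e b u)) ⟩
    ∑ (λ u → φ u * e a u - φ u * e b u)              ≡⟨ sum-distrib-- (λ u → φ u * e a u) (λ u → φ u * e b u) ⟩
    ∑ (λ u → φ u * e a u) - ∑ (λ u → φ u * e b u)    ≡⟨ cong₂ _-_ (∑-weighted-e φ a) (∑-weighted-e φ b) ⟩
    φ a - φ b                                        ∎
    where
    open ≡-Reasoning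
    open FiniteIndexProperties (finIndex N) using (sum-distrib--)
    distrib : ∀ x y z → x * (y - z) ≡ x * y - x * z
    distrib = solve 3 (λ x y z → x :* (y :- z) := x :* y :- x :* z) refl
      where open +-*-Solver

  weighted-combination : ∀ (φ : Fin N → ℚ) l →
    ∑ (λ u → φ u * combination l u) ≡ sum (λ (a , b) → l (a , b) * (φ a - φ b))
  weighted-combination φ l = begin
    ∑ (λ u → φ u * sum (λ (a , b) → l (a , b) * root a b u))
      ≡⟨ ∑-cong (λ u → FiniteIndex.*-distribˡ-sum (pairs N) (φ u) (λ (a , b) → l (a , b) * root a b u)) ⟩
    ∑ (λ u → sum (λ (a , b) → φ u * (l (a , b) * root a b u)))
      ≡⟨ sym (sum-comm-∑ (λ (a , b) u → φ u * (l (a , b) * root a b u))) ⟩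
    sum (λ (a , b) → ∑ (λ u → φ u * (l (a , b) * root a b u)))
      ≡⟨ sum-cong (λ (a , b) → pair-term a b) ⟩
    sum (λ (a , b) → l (a , b) * (φ a - φ b)) ∎
    where
    open ≡-Reasoning
    pair-term : ∀ a b → ∑ (λ u → φ u * (l (a , b) * root a b u)) ≡ l (a , b) * (φ a - φ b)
    pair-term a b = begin
      ∑ (λ u → φ u * (l (a , b) * root a b u))   ≡⟨ ∑-cong (λ u → rotate (φ u) (l (a , b)) (root a b u)) ⟩
      ∑ (λ u → l (a , b) * (φ u * root a b u))   ≡⟨ sym (*-distribˡ-∑ (l (a , b)) (λ u → φ u * root a b u)) ⟩
      l (a , b) * (φ · root a b)                 ≡⟨ cong (l (a , b) *_) (·-root φ a b) ⟩
      l (a , b) * (φ a - φ b)                    ∎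
      where
      rotate : ∀ x y z → x * (y * z) ≡ y * (x * z)
      rotate = solve 3 (λ x y z → x :* (y :* z) := y :* (x :* z)) refl
        where open +-*-Solver

  support : (Fin N × Fin N → ℚ) → PairSet N
  support l a b = not (does (l (a , b) ℚ.≟ 0ℚ))

  support-nonzero : ∀ l a b → support l a b ≡ true → l (a , b) ≢ 0ℚ
  support-nonzero l a b ab∈ lab≡0 = contradiction (trans (sym ab∈) (cong not (dec-true (l (a , b) ℚ.≟ 0ℚ) lab≡0))) λ ()

  nonzero-support : ∀ l a b → l (a , b) ≢ 0ℚ → support l a b ≡ true
  nonzero-support l a b lab≢0 = cong not (dec-false (l (a , b) ℚ.≟ 0ℚ) lab≢0)

  support-outside : ∀ l a b → support l a b ≡ false → l (a , b) ≡ 0ℚ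
  support-outside l a b ab∉ with l (a , b) ℚ.≟ 0ℚ
  ... | yes lab≡0 = lab≡0
  ... | no _      = contradiction ab∉ λ ()

  support-⊆ : ∀ {S : PairSet N} l → Supported (uncurry S) l → ∀ a b → support l a b ≡ true → S a b ≡ true
  support-⊆ {S} l supp a b ab∈ with S a b in ab∈S
  ... | true  = refl
  ... | false = contradiction (supp (a , b) ab∈S) (support-nonzero l a b ab∈)

  EdgeF-support-⊆ : ∀ {S : PairSet N} l → Supported (uncurry S) l →
                    ∀ u v → EdgeF (support l) u v ≡ true → EdgeF S u v ≡ true
  EdgeF-support-⊆ {S} l supp u v uv with support l u v in uv∈
  ... | true  = trans (cong (_∨ S v u) (support-⊆ l supp u v uv∈)) refl
  ... | false = trans (cong (S u v ∨_) (support-⊆ l supp v u uv)) (∨-zeroʳ (S u v))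

  -- Each edge of the cycle enters with the sign of its orientation in S, so the combination
  -- telescopes to ∑ₛ (e (v s) − e (v (next s))) = 0.
  cycle⇒dependent : ∀ (S : PairSet N) → HasCycle S → Dependent (uncurry S)
  cycle⇒dependent S (m , 3≤m@(s≤s (s≤s (s≤s _))) , v , v-injective , edges) =
    l , supported , (oriented zero , l-nonzero) , relation
    where
    open CyclicOrder
    open FiniteIndexProperties (pairs N) using (unit; unit-self; unit-other)
    open FiniteIndexProperties (finIndex m) using (sum-distrib--)

    forward : Fin m → Bool
    forward s = S (v s) (v (next s))

    oriented : Fin m → Fin N × Fin N
    oriented s = if forward s then (v s , v (next s)) else (v (next s) , v s)

    sign : Fin m → ℚ
    sign s = if forward s then 1ℚ else - 1ℚ

    l : Fin N × Fin N → ℚ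
    l x = ∑ (λ s → sign s * unit (oriented s) x)

    oriented-∈ : ∀ s → uncurry S (oriented s) ≡ true
    oriented-∈ s with forward s in fwd
    ... | true  = fwd
    ... | false = trans (sym (cong (_∨ S (v (next s)) (v s)) fwd)) (edges s (next s) (Consec-next s))

    signed-root : ∀ s k → sign s * uncurry root (oriented s) k ≡ root (v s) (v (next s)) k
    signed-root s k with forward s
    ... | true  = ℚ.*-identityˡ (root (v s) (v (next s)) k)
    ... | false = solve 2 (λ a b → (:- con 1ℚ) :* (b :- a) := a :- b) refl (e (v s) k) (e (v (next s)) k)
      where open +-*-Solver

    oriented-cases : ∀ s → oriented s ≡ (v s , v (next s)) ⊎ oriented s ≡ (v (next s) , v s)
    oriented-cases s with forward s
    ... | true  = inj₁ refl
    ... | false = inj₂ refl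

    reversed-impossible : ∀ s t → v s ≡ v (next t) → v (next s) ≡ v t → ⊥
    reversed-impossible s t s≡t+1 s+1≡t =
      Consec-asymmetric 3≤m (subst (Consec m s) (v-injective _ _ s+1≡t) (Consec-next s))
                            (subst (Consec m t) (v-injective _ _ (sym s≡t+1)) (Consec-next t))

    oriented-injective : ∀ s t → oriented s ≡ oriented t → s ≡ t
    oriented-injective s t eq with oriented-cases s | oriented-cases t
    ... | inj₁ os | inj₁ ot = v-injective s t (cong proj₁ (trans (sym os) (trans eq ot)))
    ... | inj₂ os | inj₂ ot = v-injective s t (cong proj₂ (trans (sym os) (trans eq ot)))
    ... | inj₁ os | inj₂ ot = ⊥-elim (reversed-impossible s t (cong proj₁ os≡ot) (cong proj₂ os≡ot))
      where os≡ot = trans (sym os) (trans eq ot)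
    ... | inj₂ os | inj₁ ot = ⊥-elim (reversed-impossible t s (sym (cong proj₁ os≡ot)) (sym (cong proj₂ os≡ot)))
      where os≡ot = trans (sym os) (trans eq ot)

    supported : Supported (uncurry S) l
    supported x x∉S = ∑-zero _ (λ s → trans (cong (sign s *_) (unit-other (oriented s) x (≢x s))) (ℚ.*-zeroʳ (sign s)))
      where
      ≢x : ∀ s → oriented s ≢ x
      ≢x s os≡x = contradiction (trans (sym x∉S) (trans (cong (uncurry S) (sym os≡x)) (oriented-∈ s))) λ ()

    sign-nonzero : ∀ s → sign s ≢ 0ℚ
    sign-nonzero s with forward s
    ... | true  = λ ()
    ... | false = λ ()

    l-nonzero : l (oriented zero) ≢ 0ℚ
    l-nonzero l≡0 = sign-nonzero zero (begin
      sign zero                                          ≡⟨ sym (ℚ.*-identityʳ (sign zero)) ⟩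
      sign zero * 1ℚ                                     ≡⟨ cong (sign zero *_) (sym (unit-self (oriented zero))) ⟩
      sign zero * unit (oriented zero) (oriented zero)   ≡⟨ sym (∑-point _ zero off) ⟩
      l (oriented zero)                                  ≡⟨ l≡0 ⟩
      0ℚ                                                 ∎)
      where
      open ≡-Reasoning
      off : ∀ s → s ≢ zero → sign s * unit (oriented s) (oriented zero) ≡ 0ℚ
      off s s≢0 = trans (cong (sign s *_) (unit-other (oriented s) (oriented zero) (s≢0 ∘ oriented-injective s zero)))
                        (ℚ.*-zeroʳ (sign s))

    relation : ∀ k → combination l k ≡ 0ℚ
    relation k = begin
      combination l k
        ≡⟨ combination-of-units oriented sign k ⟩
      ∑ (λ s → sign s * uncurry root (oriented s) k)
        ≡⟨ ∑-cong (λ s → signed-root s k) ⟩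
      ∑ (λ s → e (v s) k - e (v (next s)) k)
        ≡⟨ sum-distrib-- (λ s → e (v s) k) (λ s → e (v (next s)) k) ⟩
      ∑ (λ s → e (v s) k) - ∑ (λ s → e (v (next s)) k)
        ≡⟨ cong (_-_ (∑ (λ s → e (v s) k))) (∑-next (λ s → e (v s) k)) ⟩
      ∑ (λ s → e (v s) k) - ∑ (λ s → e (v s) k)
        ≡⟨ ℚ.+-inverseʳ (∑ (λ s → e (v s) k)) ⟩
      0ℚ ∎
      where open ≡-Reasoning

-- The edge {i, j} of G_F with i < j comes from exactly one of the pairs (i , j), (j , i) in F.
pair-count : ∀ {N} (F : PairSet N) → (∀ i → F i i ≡ false) → (∀ i j → F i j ≡ true → F j i ≡ false) →
             ∣ F ∣ ≡ numEdgeF F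
pair-count {N} F loopless antisymmetric = begin
  ∑ℕ (λ i → ∑ℕ (λ j → ⟦ F i j ⟧))
    ≡⟨ ∑ℕ-cong (λ i → ∑ℕ-cong (λ j → split i j)) ⟩
  ∑ℕ (λ i → ∑ℕ (λ j → forward i j ℕ.+ backward i j))
    ≡⟨ ∑ℕ-cong (λ i → ∑ℕ-distrib-+ (forward i) (backward i)) ⟩
  ∑ℕ (λ i → ∑ℕ (forward i) ℕ.+ ∑ℕ (backward i))
    ≡⟨ ∑ℕ-distrib-+ (λ i → ∑ℕ (forward i)) (λ i → ∑ℕ (backward i)) ⟩
  ∑ℕ (λ i → ∑ℕ (forward i)) ℕ.+ ∑ℕ (λ i → ∑ℕ (backward i))
    ≡⟨ cong (∑ℕ (λ i → ∑ℕ (forward i)) ℕ.+_) (∑ℕ-comm backward) ⟩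
  ∑ℕ (λ i → ∑ℕ (forward i)) ℕ.+ ∑ℕ (λ i → ∑ℕ (reversed i))
    ≡⟨ sym (∑ℕ-distrib-+ (λ i → ∑ℕ (forward i)) (λ i → ∑ℕ (reversed i))) ⟩
  ∑ℕ (λ i → ∑ℕ (forward i) ℕ.+ ∑ℕ (reversed i))
    ≡⟨ ∑ℕ-cong (λ i → sym (∑ℕ-distrib-+ (forward i) (reversed i))) ⟩
  ∑ℕ (λ i → ∑ℕ (λ j → forward i j ℕ.+ reversed i j))
    ≡⟨ ∑ℕ-cong (λ i → ∑ℕ-cong (λ j → merge i j)) ⟩
  numEdgeF F ∎
  where
  open ≡-Reasoning
  ⟦_⟧ : Bool → ℕ
  ⟦ b ⟧ = if b then 1 else 0
  _≺_ : Fin N → Fin N → Bool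
  i ≺ j = toℕ i <ᵇ toℕ j
  forward backward reversed : Fin N → Fin N → ℕ
  forward  i j = ⟦ i ≺ j ∧ F i j ⟧
  backward i j = ⟦ j ≺ i ∧ F i j ⟧
  reversed i j = ⟦ i ≺ j ∧ F j i ⟧
  ordered : ∀ i j → i ≢ j → (i ≺ j ≡ true × j ≺ i ≡ false) ⊎ (i ≺ j ≡ false × j ≺ i ≡ true)
  ordered i j i≢j with ℕ.<-cmp (toℕ i) (toℕ j)
  ... | tri< i<j _ j≮i = inj₁ (dec-true (toℕ i ℕ.<? toℕ j) i<j , dec-false (toℕ j ℕ.<? toℕ i) j≮i)
  ... | tri≈ _ i≡j _   = contradiction (toℕ-injective i≡j) i≢j
  ... | tri> i≮j _ j<i = inj₂ (dec-false (toℕ i ℕ.<? toℕ j) i≮j , dec-true (toℕ j ℕ.<? toℕ i) j<i)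
  split : ∀ i j → ⟦ F i j ⟧ ≡ forward i j ℕ.+ backward i j
  split i j with F i j in ij∈F
  ... | false = sym (cong₂ ℕ._+_ (cong ⟦_⟧ (∧-zeroʳ (i ≺ j))) (cong ⟦_⟧ (∧-zeroʳ (j ≺ i))))
  ... | true with ordered i j (λ { refl → contradiction (trans (sym ij∈F) (loopless i)) λ () })
  ...   | inj₁ (i<j , j≮i) = sym (cong₂ (λ p q → ⟦ p ∧ true ⟧ ℕ.+ ⟦ q ∧ true ⟧) i<j j≮i)
  ...   | inj₂ (i≮j , j<i) = sym (cong₂ (λ p q → ⟦ p ∧ true ⟧ ℕ.+ ⟦ q ∧ true ⟧) i≮j j<i)
  merge : ∀ i j → forward i j ℕ.+ reversed i j ≡ ⟦ i ≺ j ∧ EdgeF F i j ⟧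
  merge i j with i ≺ j | F i j in ij∈F | F j i in ji∈F
  ... | false | _     | _     = refl
  ... | true  | true  | true  = contradiction (trans (sym (antisymmetric i j ij∈F)) ji∈F) λ ()
  ... | true  | true  | false = refl
  ... | true  | false | true  = refl
  ... | true  | false | false = refl

module Orientation {N : ℕ} (F : PairSet N) (loopless : ∀ i → F i i ≡ false)
                   (antisymmetric : ∀ i j → F i j ≡ true → F j i ≡ false) where
  open import Data.Rational using (_-_)
  open Roots N

  support-loopless : ∀ l → Supported (uncurry F) l → ∀ u → EdgeF (support l) u u ≡ false
  support-loopless l supp u =
    trans (∨-idem (support l u u)) (¬-not λ uu∈ → contradiction (trans (sym (loopless u)) (support-⊆ l supp u u uu∈)) λ ())

  -- If v were the only support neighbour of u, the net flow l (u , v) − l (v , u) at u would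
  -- vanish, although exactly one of the two terms is nonzero.
  relation-no-dead-ends : ∀ l → Supported (uncurry F) l → (∀ k → combination l k ≡ 0ℚ) → NoDeadEnds (support l)
  relation-no-dead-ends l supp relation u v uv
    with any? (λ w → (¬? (w Fin.≟ v)) ×-dec (EdgeF (support l) u w Bool.≟ true))
  ... | yes (w , w≢v , uw) = w , w≢v , uw
  ... | no only-v = contradiction balance unbalanced
    where
    silent : ∀ w → w ≢ v → l (u , w) ≡ 0ℚ × l (w , u) ≡ 0ℚ
    silent w w≢v with support l u w in uw∈ | support l w u in wu∈
    ... | false | false = support-outside l u w uw∈ , support-outside l w u wu∈
    ... | true  | _     = contradiction (w , w≢v , trans (cong (_∨ support l w u) uw∈) refl) only-v
    ... | false | true  = contradiction (w , w≢v , trans (cong₂ _∨_ uw∈ wu∈) refl) only-v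
    balance : l (u , v) - l (v , u) ≡ 0ℚ
    balance = begin
      l (u , v) - l (v , u)
        ≡⟨ sym (cong₂ _-_ (∑-point (λ w → l (u , w)) v (λ w w≢v → proj₁ (silent w w≢v)))
                          (∑-point (λ w → l (w , u)) v (λ w w≢v → proj₂ (silent w w≢v)))) ⟩
      outflow l u - inflow l u
        ≡⟨ sym (combination-net-flow l u) ⟩
      combination l u
        ≡⟨ relation u ⟩
      0ℚ ∎
      where open ≡-Reasoning
    one-sided : l (u , v) ≡ 0ℚ ⊎ l (v , u) ≡ 0ℚ
    one-sided with F u v in uv∈F
    ... | false = inj₁ (supp (u , v) uv∈F)
    ... | true  = inj₂ (supp (v , u) (antisymmetric u v uv∈F))
    nonzero : l (u , v) ≢ 0ℚ ⊎ l (v , u) ≢ 0ℚ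
    nonzero with support l u v in uv∈
    ... | true  = inj₁ (support-nonzero l u v uv∈)
    ... | false = inj₂ (support-nonzero l v u uv)
    unbalanced : l (u , v) - l (v , u) ≢ 0ℚ
    unbalanced uv-vu≡0 with ℚ-group.x∙y⁻¹≈ε⇒x≈y (l (u , v)) (l (v , u)) uv-vu≡0 | one-sided | nonzero
    ... | _     | inj₁ uv≡0 | inj₁ uv≢0 = uv≢0 uv≡0
    ... | _     | inj₂ vu≡0 | inj₂ vu≢0 = vu≢0 vu≡0
    ... | equal | inj₁ uv≡0 | inj₂ vu≢0 = vu≢0 (trans (sym equal) uv≡0)
    ... | equal | inj₂ vu≡0 | inj₁ uv≢0 = uv≢0 (trans equal vu≡0)

  dependent⇒cycle : ∀ S → S ⊆ F → Dependent (uncurry S) → HasCycle S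
  dependent⇒cycle S S⊆F (l , supp , ((a , b) , lab≢0) , relation) =
    HasCycle-mono {A = support l} {B = S} (EdgeF-support-⊆ l supp)
      (cycle-from-edge (support l) (support-loopless l supp-F) (relation-no-dead-ends l supp-F relation) a b
        (trans (cong (_∨ support l b a) (nonzero-support l a b lab≢0)) refl))
    where
    supp-F = Supported-mono (λ (i , j) → S⊆F i j) supp

  -- The pairs of F lying on the cycle form a dependent subset, so by minimality they are all of F.
  circuit⇒chordless : Dependent (uncurry F) → (∀ S → S ⊂ F → Independent (uncurry S)) → IsChordlessCycle F
  circuit⇒chordless dependent minimal = chordless (dependent⇒cycle F (λ _ _ ab∈F → ab∈F) dependent)
    where
    chordless : HasCycle F → IsChordlessCycle F
    chordless (m , 3≤m@(s≤s (s≤s (s≤s _))) , v , v-injective , edges) = m , 3≤m , v , v-injective , vertices , edges-iff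
      where
      open CyclicOrder

      OnCycle : Fin N → Fin N → Set
      OnCycle a b = ∃ λ s → (a ≡ v s × b ≡ v (next s)) ⊎ (a ≡ v (next s) × b ≡ v s)

      on-cycle-at? : ∀ a b s → Dec ((a ≡ v s × b ≡ v (next s)) ⊎ (a ≡ v (next s) × b ≡ v s))
      on-cycle-at? a b s = ((a Fin.≟ v s) ×-dec (b Fin.≟ v (next s))) ⊎-dec ((a Fin.≟ v (next s)) ×-dec (b Fin.≟ v s))

      on-cycle? : ∀ a b → Dec (OnCycle a b)
      on-cycle? a b = any? (on-cycle-at? a b)

      OnCycle-sym : ∀ {a b} → OnCycle a b → OnCycle b a
      OnCycle-sym (s , inj₁ (a≡ , b≡)) = s , inj₂ (b≡ , a≡)
      OnCycle-sym (s , inj₂ (a≡ , b≡)) = s , inj₁ (b≡ , a≡)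

      cycle-part : PairSet N
      cycle-part a b = F a b ∧ does (on-cycle? a b)

      cycle-part-next : ∀ s → EdgeF cycle-part (v s) (v (next s)) ≡ true
      cycle-part-next s with EdgeF-cases F (v s) (v (next s)) (edges s (next s) (Consec-next s))
      ... | inj₁ fwd = cong (_∨ cycle-part (v (next s)) (v s))
                            (cong₂ _∧_ fwd (dec-true (on-cycle? (v s) (v (next s))) (s , inj₁ (refl , refl))))
      ... | inj₂ bwd = trans (cong (cycle-part (v s) (v (next s)) ∨_)
                                   (cong₂ _∧_ bwd (dec-true (on-cycle? (v (next s)) (v s)) (s , inj₂ (refl , refl)))))
                             (∨-zeroʳ _)

      cycle-part-edges : ∀ s t → Consec m s t → EdgeF cycle-part (v s) (v t) ≡ true
      cycle-part-edges s t c = subst (λ x → EdgeF cycle-part (v s) (v x) ≡ true) (sym (Consec⇒next c)) (cycle-part-next s)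

      on-cycle : ∀ a b → F a b ≡ true → OnCycle a b
      on-cycle a b ab∈F with on-cycle? a b in found
      ... | yes onCycle = onCycle
      ... | no _ = contradiction (cycle⇒dependent cycle-part (m , 3≤m , v , v-injective , cycle-part-edges))
                     (minimal cycle-part ((λ x y → ∧-conicalˡ (F x y) _) , a , b , ab∈F , ab∉cycle-part))
        where
        ab∉cycle-part : cycle-part a b ≡ false
        ab∉cycle-part = trans (cong (F a b ∧_) (cong does found)) (∧-zeroʳ (F a b))

      edge-on-cycle : ∀ a b → EdgeF F a b ≡ true → OnCycle a b
      edge-on-cycle a b e with EdgeF-cases F a b e
      ... | inj₁ ab∈F = on-cycle a b ab∈F
      ... | inj₂ ba∈F = OnCycle-sym (on-cycle b a ba∈F)

      vertices : ∀ x → (VertF F x ≡ true) ⇔ (∃ λ s → v s ≡ x)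
      vertices x = mk⇔ to from
        where
        to : VertF F x ≡ true → ∃ λ s → v s ≡ x
        to x∈V with anyFin-witness (λ u → EdgeF F u x) x∈V
        ... | u , ux with edge-on-cycle u x ux
        ...   | s , inj₁ (_ , x≡) = next s , sym x≡
        ...   | s , inj₂ (_ , x≡) = s , sym x≡
        from : (∃ λ s → v s ≡ x) → VertF F x ≡ true
        from (s , refl) = anyFin-intro (λ u → EdgeF F u (v s)) (v (prev s)) (edges (prev s) s (Consec-prev s))

      edges-iff : ∀ a b → (EdgeF F a b ≡ true) ⇔
                  (∃ λ s → ∃ λ t → Consec m s t × ((a ≡ v s × b ≡ v t) ⊎ (a ≡ v t × b ≡ v s)))
      edges-iff a b = mk⇔ to from
        where
        to : EdgeF F a b ≡ true → ∃ λ s → ∃ λ t → Consec m s t × ((a ≡ v s × b ≡ v t) ⊎ (a ≡ v t × b ≡ v s))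
        to e with edge-on-cycle a b e
        ... | s , same = s , next s , Consec-next s , same
        from : (∃ λ s → ∃ λ t → Consec m s t × ((a ≡ v s × b ≡ v t) ⊎ (a ≡ v t × b ≡ v s))) → EdgeF F a b ≡ true
        from (s , t , c , inj₁ (refl , refl)) = edges s t c
        from (s , t , c , inj₂ (refl , refl)) = EdgeF-sym F (v s) (v t) (edges s t c)

  chordless⇒circuit : IsChordlessCycle F → Dependent (uncurry F) × (∀ S → S ⊂ F → Independent (uncurry S))
  chordless⇒circuit (m , 3≤m@(s≤s (s≤s (s≤s _))) , v , v-injective , vertices , edges-iff) = dependent , minimal
    where
    open CyclicOrder

    cycle-edges : ∀ s t → Consec m s t → EdgeF F (v s) (v t) ≡ true
    cycle-edges s t c = Equivalence.from (edges-iff (v s) (v t)) (s , t , c , inj₁ (refl , refl))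

    dependent : Dependent (uncurry F)
    dependent = cycle⇒dependent F (m , 3≤m , v , v-injective , cycle-edges)

    endpoints : ∀ a b → EdgeF F a b ≡ true → ∃ λ s → (a ≡ v s × b ≡ v (next s)) ⊎ (a ≡ v (next s) × b ≡ v s)
    endpoints a b e with Equivalence.to (edges-iff a b) e
    ... | s , t , c , ends rewrite Consec⇒next c = s , ends

    neighbours : ∀ s w → EdgeF F (v s) w ≡ true → w ≡ v (next s) ⊎ w ≡ v (prev s)
    neighbours s w e with endpoints (v s) w e
    ... | s′ , inj₁ (vs≡vs′ , w≡) = inj₁ (trans w≡ (cong (v ∘ next) (sym (v-injective _ _ vs≡vs′))))
    ... | s′ , inj₂ (vs≡ , w≡) =
      inj₂ (trans w≡ (cong v (trans (sym (prev-next s′)) (cong prev (v-injective _ _ (sym vs≡))))))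

    -- The support of a relation on S has no dead ends, so it travels around the whole cycle and
    -- reaches the pair of F missing from S.
    minimal : ∀ S → S ⊂ F → Independent (uncurry S)
    minimal S (S⊆F , a , b , ab∈F , ab∉S) (l , supp , ((i , j) , lij≢0) , relation) = missing-edge-used
      where
      supp-F = Supported-mono (λ (x , y) → S⊆F x y) supp

      no-dead-ends = relation-no-dead-ends l supp-F relation

      in-F : ∀ x y → EdgeF (support l) x y ≡ true → EdgeF F x y ≡ true
      in-F = EdgeF-support-⊆ l supp-F

      Active : Fin m → Set
      Active s = EdgeF (support l) (v s) (v (next s)) ≡ true

      active-on : ∀ x y → EdgeF (support l) x y ≡ true → ∃ Active
      active-on x y xy with endpoints x y (in-F x y xy)
      ... | s , inj₁ (refl , refl) = s , xy
      ... | s , inj₂ (refl , refl) = s , EdgeF-sym (support l) _ _ xy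

      forward : ∀ s → Active s → Active (next s)
      forward s active with no-dead-ends (v (next s)) (v s) (EdgeF-sym (support l) _ _ active)
      ... | w , w≢vs , e with neighbours (next s) w (in-F _ _ e)
      ...   | inj₁ w≡ = subst (λ x → EdgeF (support l) (v (next s)) x ≡ true) w≡ e
      ...   | inj₂ w≡ = contradiction (trans w≡ (cong v (prev-next s))) w≢vs

      backward : ∀ s → Active (next s) → Active s
      backward s active with no-dead-ends (v (next s)) (v (next (next s))) active
      ... | w , w≢ , e with neighbours (next s) w (in-F _ _ e)
      ...   | inj₁ w≡ = contradiction w≡ w≢
      ...   | inj₂ w≡ = EdgeF-sym (support l) _ _
                          (subst (λ x → EdgeF (support l) (v (next s)) x ≡ true) (trans w≡ (cong v (prev-next s))) e)

      all-active : ∀ s → Active s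
      all-active = cyclic-invariant Active forward backward
                     (proj₂ (active-on i j (trans (cong (_∨ support l j i) (nonzero-support l i j lij≢0)) refl)))

      ab-active : EdgeF (support l) a b ≡ true
      ab-active with endpoints a b (cong (_∨ F b a) ab∈F)
      ... | s , inj₁ (refl , refl) = all-active s
      ... | s , inj₂ (refl , refl) = EdgeF-sym (support l) _ _ (all-active s)

      missing-edge-used : ⊥
      missing-edge-used with EdgeF-cases (support l) a b ab-active
      ... | inj₁ ab∈ = contradiction (trans (sym ab∉S) (support-⊆ l supp a b ab∈)) λ ()
      ... | inj₂ ba∈ = contradiction (trans (sym (antisymmetric a b ab∈F)) (S⊆F b a (support-⊆ l supp b a ba∈))) λ ()

vertices-of-edge : ∀ {N} (F : PairSet N) a b → F a b ≡ true → VertF F a ≡ true × VertF F b ≡ true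
vertices-of-edge F a b ab∈F =
  anyFin-intro (λ u → EdgeF F u a) b (trans (cong (F b a ∨_) ab∈F) (∨-zeroʳ (F b a))) ,
  anyFin-intro (λ u → EdgeF F u b) a (cong (_∨ F b a) ab∈F)

module Rank {N : ℕ} (F : PairSet N) (root-of : Fin N → Fin N)
            (root-of-edge : ∀ a b → F a b ≡ true → root-of a ≡ root-of b)
            (walk-to-root : ∀ v → VertF F v ≡ true → Walk (EdgeF F) v (root-of v))
            (root-of-idempotent : ∀ v → VertF F v ≡ true → root-of (root-of v) ≡ root-of v) where
  open import Data.Rational using (_-_)
  open Roots N
  open FiniteIndex (pairs N) using (sum)
  open FiniteIndexProperties (pairs N) using (count; sum-zero)
  private
    module V = FiniteIndexProperties (finIndex N)

  nonroot : Fin N → Bool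
  nonroot v = VertF F v ∧ not (does (root-of v Fin.≟ v))

  nonroot-intro : ∀ v → VertF F v ≡ true → root-of v ≢ v → nonroot v ≡ true
  nonroot-intro v v∈V not-root = cong₂ (λ p q → p ∧ not q) v∈V (dec-false (root-of v Fin.≟ v) not-root)

  root-not-nonroot : ∀ v → root-of v ≡ v → nonroot v ≡ false
  root-not-nonroot v root = trans (cong (λ t → VertF F v ∧ not t) (dec-true (root-of v Fin.≟ v) root)) (∧-zeroʳ (VertF F v))

  private
    vertex-of-support : ∀ l → Supported (uncurry F) l → ∀ a b → l (a , b) ≢ 0ℚ → VertF F a ≡ true × VertF F b ≡ true
    vertex-of-support l supp a b lab≢0 with F a b in ab∈F
    ... | true  = vertices-of-edge F a b ab∈F
    ... | false = contradiction (supp (a , b) ab∈F) lab≢0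

    silent-off-vertices : ∀ l → Supported (uncurry F) l → ∀ x → VertF F x ≡ false → combination l x ≡ 0ℚ
    silent-off-vertices l supp x x∉V = begin
      combination l x
        ≡⟨ combination-net-flow l x ⟩
      outflow l x - inflow l x
        ≡⟨ cong₂ _-_ (∑-zero _ (λ b → silent (λ lxb≢0 → proj₁ (vertex-of-support l supp x b lxb≢0))))
                     (∑-zero _ (λ a → silent (λ lax≢0 → proj₂ (vertex-of-support l supp a x lax≢0)))) ⟩
      0ℚ - 0ℚ
        ≡⟨⟩
      0ℚ ∎
      where
      open ≡-Reasoning
      silent : ∀ {q} → (q ≢ 0ℚ → VertF F x ≡ true) → q ≡ 0ℚ
      silent {q} q-vertex with q ℚ.≟ 0ℚ
      ... | yes q≡0 = q≡0
      ... | no q≢0  = contradiction (trans (sym x∉V) (q-vertex q≢0)) λ ()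

    silent-at-roots : ∀ l → Supported (uncurry F) l → (∀ v → nonroot v ≡ true → combination l v ≡ 0ℚ) →
                      ∀ x → VertF F x ≡ true → root-of x ≡ x → combination l x ≡ 0ℚ
    silent-at-roots l supp silent-nonroots x x∈V root-x = begin
      combination l x                                  ≡⟨ sym (ℚ.*-identityˡ _) ⟩
      1ℚ * combination l x                             ≡⟨ cong (_* combination l x) (sym class-x) ⟩
      class x * combination l x                        ≡⟨ sym (∑-point _ x others) ⟩
      ∑ (λ u → class u * combination l u)              ≡⟨ weighted-combination class l ⟩
      sum (λ (a , b) → l (a , b) * (class a - class b)) ≡⟨ sum-zero _ (λ (a , b) → edge-term a b) ⟩
      0ℚ                                               ∎
      where
      open ≡-Reasoning
      in-class : Fin N → Bool
      in-class u = VertF F u ∧ does (root-of u Fin.≟ x)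
      class : Fin N → ℚ
      class u = if in-class u then 1ℚ else 0ℚ
      class-x : class x ≡ 1ℚ
      class-x rewrite x∈V | dec-true (root-of x Fin.≟ x) root-x = refl
      others : ∀ u → u ≢ x → class u * combination l u ≡ 0ℚ
      others u u≢x with in-class u in u∈class
      ... | false = ℚ.*-zeroˡ (combination l u)
      ... | true  = trans (cong (1ℚ *_) (silent-nonroots u u-nonroot)) (ℚ.*-zeroʳ 1ℚ)
        where
        u∈V = ∧-conicalˡ (VertF F u) _ u∈class
        root-u : root-of u ≡ x
        root-u with root-of u Fin.≟ x
        ... | yes eq = eq
        ... | no _   = contradiction (trans (sym u∈class) (∧-zeroʳ (VertF F u))) λ ()
        u-nonroot : nonroot u ≡ true
        u-nonroot = nonroot-intro u u∈V (λ ru≡u → u≢x (trans (sym ru≡u) root-u))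
      edge-term : ∀ a b → l (a , b) * (class a - class b) ≡ 0ℚ
      edge-term a b with l (a , b) ℚ.≟ 0ℚ
      ... | yes lab≡0 = trans (cong (_* (class a - class b)) lab≡0) (ℚ.*-zeroˡ (class a - class b))
      ... | no lab≢0  = trans (cong (l (a , b) *_) same-class) (ℚ.*-zeroʳ (l (a , b)))
        where
        ab∈F : F a b ≡ true
        ab∈F with F a b in ab∈F
        ... | true  = refl
        ... | false = contradiction (supp (a , b) ab∈F) lab≢0
        same-in-class : in-class a ≡ in-class b
        same-in-class = cong₂ (λ p q → p ∧ does (q Fin.≟ x))
                              (trans (proj₁ (vertices-of-edge F a b ab∈F)) (sym (proj₂ (vertices-of-edge F a b ab∈F))))
                              (root-of-edge a b ab∈F)
        same-class : class a - class b ≡ 0ℚ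
        same-class = trans (cong (λ t → (if t then 1ℚ else 0ℚ) - class b) same-in-class) (ℚ.+-inverseʳ (class b))

    -- A combination vanishes off V(G_F) and its coordinates sum to zero over each component
    -- (`silent-at-roots`), so it is determined by its coordinates at the non-roots.
    determined-by-nonroots : ∀ l → Supported (uncurry F) l → (∀ v → nonroot v ≡ true → combination l v ≡ 0ℚ) →
                             ∀ x → combination l x ≡ 0ℚ
    determined-by-nonroots l supp silent x with VertF F x in x∈V | root-of x Fin.≟ x
    ... | false | _         = silent-off-vertices l supp x x∈V
    ... | true  | yes root-x = silent-at-roots l supp silent x x∈V root-x
    ... | true  | no ¬root-x = silent x (nonroot-intro x x∈V ¬root-x)

  independent-bound : ∀ S → S ⊆ F → Independent (uncurry S) → count (uncurry S) ≤ V.count nonroot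
  independent-bound S S⊆F independent = determining-coordinates-bound (uncurry S) nonroot trivial
    where
    trivial : ∀ l → Supported (uncurry S) l → (∀ v → nonroot v ≡ true → combination l v ≡ 0ℚ) → ∀ x → l x ≡ 0ℚ
    trivial l supp silent x with l x ℚ.≟ 0ℚ
    ... | yes lx≡0 = lx≡0
    ... | no lx≢0  = contradiction (l , supp , (x , lx≢0) , determined-by-nonroots l supp-F silent) independent
      where supp-F = Supported-mono (λ (a , b) → S⊆F a b) supp

  private
    maximal = maximal-independent (uncurry F)
    B = proj₁ maximal
    B⊆F = proj₁ (proj₂ maximal)
    B-independent = proj₁ (proj₂ (proj₂ maximal))
    B-spans = proj₂ (proj₂ (proj₂ maximal))

    span-edge : ∀ a b → EdgeF F a b ≡ true → InSpan B (root a b)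
    span-edge a b ab with EdgeF-cases F a b ab
    ... | inj₁ ab∈F = B-spans (a , b) ab∈F
    ... | inj₂ ba∈F = span-cong (λ k → sym (root-antisym b a k)) (span-neg (B-spans (b , a) ba∈F))

    span-walk : ∀ a b → Walk (EdgeF F) a b → InSpan B (root a b)
    span-walk a .a here = span-cong (λ k → sym (ℚ.+-inverseʳ (e a k))) (span-zero B)
    span-walk a b (step {v = c} ac rest) =
      span-cong (λ k → telescope (e a k) (e c k) (e b k)) (span-+ (span-edge a c ac) (span-walk c b rest))
      where
      telescope : ∀ x y z → (x - y) + (y - z) ≡ x - z
      telescope = solve 3 (λ x y z → (x :- y) :+ (y :- z) := x :- z) refl
        where open +-*-Solver

    to-root : Fin N → Vecℚ N
    to-root v = root v (root-of v)

    to-root-independent : ∀ ν → Supported nonroot ν → (∀ k → ∑ (λ v → ν v * to-root v k) ≡ 0ℚ) →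
                          ∀ v → ν v ≡ 0ℚ
    to-root-independent ν supp relation v₀ with nonroot v₀ in v₀-nonroot
    ... | false = supp v₀ v₀-nonroot
    ... | true  = begin
      ν v₀                                 ≡⟨ sym (ℚ.*-identityʳ (ν v₀)) ⟩
      ν v₀ * 1ℚ                            ≡⟨ cong (ν v₀ *_) (sym (at-v₀ v₀ v₀-nonroot)) ⟩
      ν v₀ * to-root v₀ v₀                 ≡⟨ sym (∑-point _ v₀ others) ⟩
      ∑ (λ v → ν v * to-root v v₀)         ≡⟨ relation v₀ ⟩
      0ℚ                                   ∎
      where
      open ≡-Reasoning
      root-not-v₀ : ∀ v → nonroot v ≡ true → root-of v ≢ v₀
      root-not-v₀ v v-nonroot refl =
        contradiction (trans (sym v₀-nonroot) (root-not-nonroot (root-of v) (root-of-idempotent v (∧-conicalˡ _ _ v-nonroot)))) λ ()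
      at-v₀ : ∀ v → nonroot v ≡ true → to-root v v ≡ 1ℚ
      at-v₀ v v-nonroot = cong₂ _-_ (e-self v) (e-other (root-of v) v λ rv≡v →
        contradiction (trans (sym v-nonroot) (root-not-nonroot v rv≡v)) λ ())
      others : ∀ v → v ≢ v₀ → ν v * to-root v v₀ ≡ 0ℚ
      others v v≢v₀ with nonroot v in v-nonroot
      ... | false = trans (cong (_* to-root v v₀) (supp v v-nonroot)) (ℚ.*-zeroˡ (to-root v v₀))
      ... | true  = trans (cong (ν v *_) (cong₂ _-_ (e-other v v₀ v≢v₀) (e-other (root-of v) v₀ (root-not-v₀ v v-nonroot))))
                          (ℚ.*-zeroʳ (ν v))

  -- A maximal independent subset of F spans each e_v − e_(root-of v) along a walk, and these
  -- vectors, v a non-root, are independent.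
  rank : ∃ λ S → S ⊆ F × Independent (uncurry S) × count (uncurry S) ≡ V.count nonroot
  rank = (λ a b → B (a , b)) , (λ a b → B⊆F (a , b)) , B-independent ,
         ℕ.≤-antisym (independent-bound (λ a b → B (a , b)) (λ a b → B⊆F (a , b)) B-independent)
                     (span-count to-root nonroot B spans to-root-independent)
    where
    spans : ∀ v → nonroot v ≡ true → InSpan B (to-root v)
    spans v v-nonroot = span-walk v (root-of v) (walk-to-root v (∧-conicalˡ _ _ v-nonroot))

module Components {N : ℕ} (F : PairSet N) (k : ℕ) (components : HasComponents F k) where
  open FiniteIndexProperties (finIndex N) using (count; count-split; count-cong; count-image)

  private
    comp = proj₁ components
    surj = proj₁ (proj₂ components)
    walk-iff = proj₂ (proj₂ components)

    rep : Fin k → Fin N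
    rep c = proj₁ (surj c)

    rep-vertex : ∀ c → VertF F (rep c) ≡ true
    rep-vertex c = proj₁ (proj₂ (surj c))

    rep-component : ∀ c → comp (rep c) (rep-vertex c) ≡ c
    rep-component c = proj₂ (proj₂ (surj c))

    comp-irrelevant : ∀ v (p q : VertF F v ≡ true) → comp v p ≡ comp v q
    comp-irrelevant v p q = cong (comp v) (Decidable⇒UIP.≡-irrelevant Bool._≟_ p q)

    comp-cong : ∀ {u w} → u ≡ w → (p : VertF F u ≡ true) (q : VertF F w ≡ true) → comp u p ≡ comp w q
    comp-cong {u} refl p q = comp-irrelevant u p q

    rep-injective : ∀ c c′ → rep c ≡ rep c′ → c ≡ c′
    rep-injective c c′ eq =
      trans (sym (rep-component c)) (trans (comp-cong eq (rep-vertex c) (rep-vertex c′)) (rep-component c′))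

    -- the representative of the component of v, and v itself if v is not a vertex of G_F
    root-of′ : ∀ v b → VertF F v ≡ b → Fin N
    root-of′ v true  v∈V = rep (comp v v∈V)
    root-of′ v false _   = v

  root-of : Fin N → Fin N
  root-of v = root-of′ v (VertF F v) refl

  root-of-vertex : ∀ v (p : VertF F v ≡ true) → root-of v ≡ rep (comp v p)
  root-of-vertex v p = at (VertF F v) refl
    where
    at : ∀ b (v∈V : VertF F v ≡ b) → root-of′ v b v∈V ≡ rep (comp v p)
    at true  v∈V = cong rep (comp-irrelevant v v∈V p)
    at false v∉V = contradiction (trans (sym v∉V) p) λ ()

  root-of-edge : ∀ a b → F a b ≡ true → root-of a ≡ root-of b
  root-of-edge a b ab∈F = begin
    root-of a           ≡⟨ root-of-vertex a a∈V ⟩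
    rep (comp a a∈V)    ≡⟨ cong rep (Equivalence.from (walk-iff a a∈V b b∈V) (step (cong (_∨ F b a) ab∈F) here)) ⟩
    rep (comp b b∈V)    ≡⟨ sym (root-of-vertex b b∈V) ⟩
    root-of b           ∎
    where
    open ≡-Reasoning
    a∈V = proj₁ (vertices-of-edge F a b ab∈F)
    b∈V = proj₂ (vertices-of-edge F a b ab∈F)

  walk-to-root : ∀ v → VertF F v ≡ true → Walk (EdgeF F) v (root-of v)
  walk-to-root v v∈V = subst (Walk (EdgeF F) v) (sym (root-of-vertex v v∈V))
    (Equivalence.to (walk-iff v v∈V (rep c) (rep-vertex c)) (sym (rep-component c)))
    where c = comp v v∈V

  root-of-rep : ∀ c → root-of (rep c) ≡ rep c
  root-of-rep c = trans (root-of-vertex (rep c) (rep-vertex c)) (cong rep (rep-component c))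

  root-of-idempotent : ∀ v → VertF F v ≡ true → root-of (root-of v) ≡ root-of v
  root-of-idempotent v v∈V rewrite root-of-vertex v v∈V = root-of-rep (comp v v∈V)

  roots-are-reps : ∀ v → (VertF F v ∧ does (root-of v Fin.≟ v)) ≡ anyFin (λ c → does (rep c Fin.≟ v))
  roots-are-reps v = ⇔→≡ {z = true} (mk⇔ to from)
    where
    to : VertF F v ∧ does (root-of v Fin.≟ v) ≡ true → anyFin (λ c → does (rep c Fin.≟ v)) ≡ true
    to root = anyFin-intro _ (comp v v∈V) (dec-true (rep (comp v v∈V) Fin.≟ v) (trans (sym (root-of-vertex v v∈V)) rv≡v))
      where
      v∈V = ∧-conicalˡ (VertF F v) _ root
      rv≡v = from-does (root-of v Fin.≟ v) (∧-conicalʳ (VertF F v) _ root)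
    from : anyFin (λ c → does (rep c Fin.≟ v)) ≡ true → VertF F v ∧ does (root-of v Fin.≟ v) ≡ true
    from found with anyFin-witness _ found
    ... | c , rep-c with from-does (rep c Fin.≟ v) rep-c
    ... | refl = cong₂ _∧_ (rep-vertex c) (dec-true (root-of (rep c) Fin.≟ rep c) (root-of-rep c))

  vertex-count : count (VertF F) ≡ count (λ v → VertF F v ∧ not (does (root-of v Fin.≟ v))) ℕ.+ k
  vertex-count = begin
    count (VertF F)
      ≡⟨ count-split (VertF F) (λ v → does (root-of v Fin.≟ v)) ⟩
    count (λ v → VertF F v ∧ does (root-of v Fin.≟ v)) ℕ.+ count nonroot
      ≡⟨ cong (ℕ._+ count nonroot) (trans (count-cong roots-are-reps) (count-image rep rep-injective)) ⟩
    k ℕ.+ count nonroot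
      ≡⟨ ℕ.+-comm k _ ⟩
    count nonroot ℕ.+ k ∎
    where
    open ≡-Reasoning
    nonroot : Fin N → Bool
    nonroot v = VertF F v ∧ not (does (root-of v Fin.≟ v))

HasDim-unique : ∀ {N} {S : PairSet N} {d d′} → HasDim S d → HasDim S d′ → d ≡ d′
HasDim-unique ((T , T⊆S , T-independent , #T) , bound) ((T′ , T′⊆S , T′-independent , #T′) , bound′) =
  ℕ.suc-injective (ℕ.≤-antisym (subst (ℕ._≤ _) #T (bound′ T T⊆S T-independent))
                               (subst (ℕ._≤ _) #T′ (bound T′ T′⊆S T′-independent)))

module ProperFace {N : ℕ} (G : Graph N) (simple : IsSimple G) (F : PairSet N) (c : Vecℚ N)
  (face : ∀ i j → (F i j ≡ true) ⇔ (G i j ≡ true × (∀ k l → G k l ≡ true → c · root k l ℚ.≤ c · root i j)))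
  (nonempty : Nonempty F) (proper : F ⊂ ∇ G) where

  open Roots N
  open import Data.Rational using (_-_)

  private
    i₀ = proj₁ nonempty
    j₀ = proj₁ (proj₂ nonempty)
    i₀j₀∈F = proj₂ (proj₂ nonempty)
    F⊆G = proj₁ proper
    i₁ = proj₁ (proj₂ proper)
    j₁ = proj₁ (proj₂ (proj₂ proper))
    i₁j₁∈G = proj₁ (proj₂ (proj₂ (proj₂ proper)))
    i₁j₁∉F = proj₂ (proj₂ (proj₂ (proj₂ proper)))

  height : Fin N → Fin N → ℚ
  height i j = c · root i j

  level : ℚ
  level = height i₀ j₀

  height-maximal : ∀ i j → F i j ≡ true → ∀ k l → G k l ≡ true → height k l ℚ.≤ height i j
  height-maximal i j ij∈F = proj₂ (Equivalence.to (face i j) ij∈F)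

  height-on-F : ∀ i j → F i j ≡ true → height i j ≡ level
  height-on-F i j ij∈F = ℚ.≤-antisym (height-maximal i₀ j₀ i₀j₀∈F i j (F⊆G i j ij∈F))
                                     (height-maximal i j ij∈F i₀ j₀ (F⊆G i₀ j₀ i₀j₀∈F))

  height-antisym : ∀ i j → height j i ≡ - height i j
  height-antisym i j = begin
    height j i       ≡⟨ ·-root c j i ⟩
    c j - c i        ≡⟨ solve 2 (λ x y → y :- x := :- (x :- y)) refl (c i) (c j) ⟩
    - (c i - c j)    ≡⟨ cong -_ (sym (·-root c i j)) ⟩
    - height i j     ∎
    where
    open ≡-Reasoning
    open +-*-Solver

  level≢0 : level ≢ 0ℚ
  level≢0 level≡0 =
    contradiction (trans (sym (Equivalence.from (face i₁ j₁) (i₁j₁∈G , i₁j₁-maximal))) i₁j₁∉F) λ ()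
    where
    below-0 : ∀ k l → G k l ≡ true → height k l ℚ.≤ 0ℚ
    below-0 k l kl∈G = subst (height k l ℚ.≤_) level≡0 (height-maximal i₀ j₀ i₀j₀∈F k l kl∈G)
    i₁j₁-maximal : ∀ k l → G k l ≡ true → height k l ℚ.≤ height i₁ j₁
    i₁j₁-maximal k l kl∈G = ℚ.≤-trans (below-0 k l kl∈G)
      (subst (0ℚ ℚ.≤_) (sym (height-antisym j₁ i₁))
        (ℚ.neg-antimono-≤ (below-0 j₁ i₁ (trans (proj₁ simple j₁ i₁) i₁j₁∈G))))

  loopless : ∀ i → F i i ≡ false
  loopless i with F i i in ii∈F
  ... | false = refl
  ... | true  = contradiction (trans (sym (proj₂ simple i)) (F⊆G i i ii∈F)) λ ()

  antisymmetric : ∀ i j → F i j ≡ true → F j i ≡ false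
  antisymmetric i j ij∈F with F j i in ji∈F
  ... | false = refl
  ... | true  = contradiction (self-negative level≡-level) level≢0
    where
    level≡-level : level ≡ - level
    level≡-level = trans (sym (height-on-F j i ji∈F)) (trans (height-antisym i j) (cong -_ (height-on-F i j ij∈F)))
    self-negative : ∀ {x} → x ≡ - x → x ≡ 0ℚ
    self-negative {x} x≡-x = *-cancelʳ-nonzero x (1ℚ + 1ℚ) (λ ()) (begin
      x * (1ℚ + 1ℚ)   ≡⟨ solve 1 (λ x → x :* (con 1ℚ :+ con 1ℚ) := x :+ x) refl x ⟩
      x + x           ≡⟨ cong (x +_) x≡-x ⟩
      x + - x         ≡⟨ ℚ.+-inverseʳ x ⟩
      0ℚ              ∎)
      where
      open ≡-Reasoning
      open +-*-Solver

  -- F lies in the hyperplane c · x = level ≠ 0, so the coefficients of a linear relation among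
  -- points of F sum to zero.
  affine⇔linear : ∀ S → S ⊆ F → AffinelyDependent S ⇔ Dependent (uncurry S)
  affine⇔linear S S⊆F = mk⇔ to from
    where
    to : AffinelyDependent S → Dependent (uncurry S)
    to (l , supp , (i , j , lij≢0) , _ , relation) = uncurry l , (λ (a , b) → supp a b) , ((i , j) , lij≢0) , relation
    from : Dependent (uncurry S) → AffinelyDependent S
    from (l , supp , ((i , j) , lij≢0) , relation) =
      (λ a b → l (a , b)) , (λ a b → supp (a , b)) , (i , j , lij≢0) , total-zero , relation
      where
      open FiniteIndex (pairs N) using (sum; sum-cong)
      open FiniteIndexProperties (pairs N) using (*-distribʳ-sum)
      on-level : ∀ a b → l (a , b) * level ≡ l (a , b) * (c a - c b)
      on-level a b with S a b in ab∈S
      ... | true  = cong (l (a , b) *_) (trans (sym (height-on-F a b (S⊆F a b ab∈S))) (·-root c a b))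
      ... | false rewrite supp (a , b) ab∈S = trans (ℚ.*-zeroˡ level) (sym (ℚ.*-zeroˡ (c a - c b)))
      total-zero : sum l ≡ 0ℚ
      total-zero = *-cancelʳ-nonzero (sum l) level level≢0 (begin
        sum l * level
          ≡⟨ *-distribʳ-sum level l ⟩
        sum (λ (a , b) → l (a , b) * level)
          ≡⟨ sum-cong (λ (a , b) → on-level a b) ⟩
        sum (λ (a , b) → l (a , b) * (c a - c b))
          ≡⟨ sym (weighted-combination c l) ⟩
        ∑ (λ u → c u * combination l u)
          ≡⟨ ∑-zero _ (λ u → trans (cong (c u *_) (relation u)) (ℚ.*-zeroʳ (c u))) ⟩
        0ℚ ∎)
        where open ≡-Reasoning

  dimension : ∀ k → HasComponents F k → ∃[ d ] (HasDim F d × suc d ℕ.+ k ≡ numVertF F)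
  dimension k components = d , (witness , bound) , vertex-equation
    where
    open Components F k components
    open Rank F root-of root-of-edge walk-to-root root-of-idempotent
    module V = FiniteIndexProperties (finIndex N)

    root-unless-nonroot : ∀ v → VertF F v ≡ true → nonroot v ≡ false → root-of v ≡ v
    root-unless-nonroot v v∈V not-nonroot with root-of v Fin.≟ v
    ... | yes root = root
    ... | no _     = contradiction (trans (sym not-nonroot) (cong (_∧ true) v∈V)) λ ()

    nonroot-exists : ∃ λ v → nonroot v ≡ true
    nonroot-exists with nonroot i₀ in i₀-nonroot | nonroot j₀ in j₀-nonroot
    ... | true  | _     = i₀ , i₀-nonroot
    ... | false | true  = j₀ , j₀-nonroot
    ... | false | false =
      contradiction (trans (sym (loopless i₀)) (subst (λ x → F i₀ x ≡ true) (sym i₀≡j₀) i₀j₀∈F)) λ ()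
      where
      i₀≡j₀ : i₀ ≡ j₀
      i₀≡j₀ = begin
        i₀            ≡⟨ sym (root-unless-nonroot i₀ (proj₁ (vertices-of-edge F i₀ j₀ i₀j₀∈F)) i₀-nonroot) ⟩
        root-of i₀    ≡⟨ root-of-edge i₀ j₀ i₀j₀∈F ⟩
        root-of j₀    ≡⟨ root-unless-nonroot j₀ (proj₂ (vertices-of-edge F i₀ j₀ i₀j₀∈F)) j₀-nonroot ⟩
        j₀            ∎
        where open ≡-Reasoning

    positive : ∀ {n} → 1 ≤ n → ∃ λ d → n ≡ suc d
    positive {suc d} _ = d , refl

    d = proj₁ (positive (V.count-pos nonroot (proj₁ nonroot-exists) (proj₂ nonroot-exists)))
    #nonroot : V.count nonroot ≡ suc d
    #nonroot = proj₂ (positive (V.count-pos nonroot (proj₁ nonroot-exists) (proj₂ nonroot-exists)))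

    witness : ∃ λ S → S ⊆ F × AffinelyIndependent S × ∣ S ∣ ≡ suc d
    witness with rank
    ... | S , S⊆F , independent , #S =
      S , S⊆F , (λ dep → independent (Equivalence.to (affine⇔linear S S⊆F) dep)) , trans #S #nonroot

    bound : ∀ S → S ⊆ F → AffinelyIndependent S → ∣ S ∣ ≤ suc d
    bound S S⊆F independent = subst (∣ S ∣ ≤_) #nonroot
      (independent-bound S S⊆F (λ dep → independent (Equivalence.from (affine⇔linear S S⊆F) dep)))

    vertex-equation : suc d ℕ.+ k ≡ numVertF F
    vertex-equation = trans (cong (ℕ._+ k) (sym #nonroot)) (sym vertex-count)

-- From here on `_-_` is integer subtraction, as in the statement.
open import Data.Integer using (+_; _-_; 1ℤ)

dimension-arithmetic : ∀ d k v → suc d ℕ.+ k ≡ v → + d ≡ + v - + k - 1ℤ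
dimension-arithmetic d k v eq = begin
  + d
    ≡⟨ solve 2 (λ d k → d := ((con 1ℤ :+ d) :+ k) :- k :- con 1ℤ) refl (+ d) (+ k) ⟩
  + suc d ℤ.+ + k - + k - 1ℤ
    ≡⟨ cong (λ z → z - + k - 1ℤ) (sym (ℤ.pos-+ (suc d) k)) ⟩
  + (suc d ℕ.+ k) - + k - 1ℤ
    ≡⟨ cong (λ z → + z - + k - 1ℤ) eq ⟩
  + v - + k - 1ℤ ∎
  where
  open ≡-Reasoning
  open ℤ-Solver

corank-arithmetic : ∀ e v k d → + d ≡ + v - + k - 1ℤ → + e - + d - 1ℤ ≡ + e - + v ℤ.+ + k
corank-arithmetic e v k d d≡ = begin
  + e - + d - 1ℤ
    ≡⟨ cong (λ z → + e - z - 1ℤ) d≡ ⟩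
  + e - (+ v - + k - 1ℤ) - 1ℤ
    ≡⟨ solve 3 (λ e v k → e :- (v :- k :- con 1ℤ) :- con 1ℤ := e :- v :+ k) refl (+ e) (+ v) (+ k) ⟩
  + e - + v ℤ.+ + k ∎
  where
  open ≡-Reasoning
  open ℤ-Solver

mainTheorem9 :
    (N : ℕ) (G : Graph N) → IsSimple G → IsConnected G → HasEdge G →
    (F : PairSet N) → IsFace G F → Nonempty F → F ⊂ ∇ G →
      (AffinelyIndependent F ⇔ IsForest F)
    × (IsCircuit F ⇔ IsChordlessCycle F)
    × (∀ k → HasComponents F k →
         ∃[ d ] (HasDim F d × (+ d) ≡ (+ numVertF F) - (+ k) - 1ℤ))
    × (∀ k d → HasComponents F k → HasDim F d → corank F d ≡ cyclomatic F k)
mainTheorem9 N G simple _ _ F (inj₁ empty) (i , j , ij∈F) _ = contradiction (trans (sym (empty i j)) ij∈F) λ ()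
mainTheorem9 N G simple _ _ F (inj₂ (c , face)) nonempty proper =
  forest , circuit , dimension-formula , corank-formula
  where
  open ProperFace G simple F c face nonempty proper
  open Orientation F loopless antisymmetric
  open Roots N using (Dependent; cycle⇒dependent)

  F-linear : AffinelyDependent F ⇔ Dependent (uncurry F)
  F-linear = affine⇔linear F (λ _ _ ij∈F → ij∈F)

  forest : AffinelyIndependent F ⇔ IsForest F
  forest = mk⇔ (λ independent → independent ∘ Equivalence.from F-linear ∘ cycle⇒dependent F)
               (λ acyclic → acyclic ∘ dependent⇒cycle F (λ _ _ ij∈F → ij∈F) ∘ Equivalence.to F-linear)

  circuit : IsCircuit F ⇔ IsChordlessCycle F
  circuit = mk⇔
    (λ (dependent , minimal) → circuit⇒chordless (Equivalence.to F-linear dependent)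
       (λ S S⊂F → minimal S S⊂F ∘ Equivalence.from (affine⇔linear S (proj₁ S⊂F))))
    (λ chordless → let (dependent , minimal) = chordless⇒circuit chordless in
       Equivalence.from F-linear dependent , λ S S⊂F → minimal S S⊂F ∘ Equivalence.to (affine⇔linear S (proj₁ S⊂F)))

  dimension-formula : ∀ k → HasComponents F k → ∃[ d ] (HasDim F d × (+ d) ≡ (+ numVertF F) - (+ k) - 1ℤ)
  dimension-formula k components =
    let (d , has-dim , vertices) = dimension k components in
    d , has-dim , dimension-arithmetic d k (numVertF F) vertices

  corank-formula : ∀ k d → HasComponents F k → HasDim F d → corank F d ≡ cyclomatic F k
  corank-formula k d components has-dim =
    let (d′ , has-dim′ , vertices) = dimension k components in
    trans (cong₂ (λ e x → + e - + x - 1ℤ) (pair-count F loopless antisymmetric) (HasDim-unique has-dim has-dim′))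
          (corank-arithmetic (numEdgeF F) (numVertF F) k d′ (dimension-arithmetic d′ k (numVertF F) vertices))
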